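{- Let $\alpha=(\alpha_1,\dots,\alpha_m)$ be a weak composition of $n\geq1$ with $m$ parts, let $d\mid m$, and let $\underline{\alpha}=((\alpha_1),\dots,(\alpha_m))$ be the corresponding sequence of one-row partitions. Then \[ \left[\!\left[\begin{smallmatrix}n\\\alpha\end{smallmatrix}\right]\!\right]_{q;d}=\frac{\sum_{\sigma\in C_d}q^{b(\sigma\cdot\alpha)}}{[d]_{q^{nm/d}}}\binom{n}{\alpha}_{q^m}=\sum_{\sigma\in C_d}q^{b(\sigma\cdot\alpha)}p^{(m/d)}_{\sigma\cdot\alpha}(q^m)=\frac{d}{\#\{\underline{\alpha}\}^d}\,g^{\{\underline{\alpha}\}^d}(q). \]
   Context: $[j]_q=1+\dots+q^{j-1}$, $[a]_q!=[a]_q\cdots[1]_q$; for $\beta\in\mathbb{Z}^m$ summing to $N$, $\binom{N}{\beta}_q=[N]_q!/\prod[\beta_i]_q!$ if all $\beta_i\geq0$, else $0$; $\mathrm{dec}_i\beta$ decreases $\beta_i$ by $1$. $\sigma_m\cdot\alpha=(\alpha_m,\alpha_1,\dots,\alpha_{m-1})$, $C_d=\langle\sigma_m^{m/d}\rangle$ acting on length-$m$ sequences (of numbers or of partitions) by rotation, $b(\alpha)=\sum(i-1)\alpha_i$. $\left[\!\left[\begin{smallmatrix}n\\\alpha\end{smallmatrix}\right]\!\right]_{q;d}$ is defined by the first expression. $p_\beta^{(k)}(q)=\sum_{i=1}^kq^{\beta_1+\cdots+\beta_{i-1}}\binom{n-1}{\mathrm{dec}_i\beta}_q$. For a sequence $\underline{\lambda}$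 of $m$ partitions of total size $n$, $\{\underline{\lambda}\}^d$ is its $C_d$-orbit, $\alpha(\underline{\lambda})=(|\lambda^{(1)}|,\dots,|\lambda^{(m)}|)$, and $g^{\{\underline{\lambda}\}^d}(q)$ is the fake degree polynomial of the corresponding irreducibles of the Shephard–Todd group $G(m,d,n)$; by Stembridge's theorem it equals $\frac{\sum_{\underline{\mu}\in\{\underline{\lambda}\}^d}q^{b(\alpha(\underline{\mu}))}}{[d]_{q^{nm/d}}}\mathrm{SYT}(\underline{\lambda})^{\mathrm{maj}}(q^m)$, where $\mathrm{SYT}(\underline{\lambda})^{\mathrm{maj}}(q)=\sum_Tq^{\mathrm{maj}(T)}$ over standard tableaux $T$ of the block diagonal skew shape with $\lambda^{(1)},\dots,\lambda^{(m)}$ placed in disjoint rows and columns going from top-right to bottom-left, $\mathrm{maj}$ being the sum of $i$ such that $i+1$ is in a strictly lower row. -}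

module Defs where

open import Data.Nat using (ℕ; zero; suc; _+_; _*_; _∸_; _^_; _≤ᵇ_; _≡ᵇ_; _<ᵇ_; _/_; _≟_)
open import Data.Bool using (Bool; true; false; _∧_; _∨_; if_then_else_)
open import Data.List using (List; []; _∷_; _++_; map; length; take; inits; concatMap; upTo; deduplicate; filterᵇ)
open import Data.Bool.ListAction using (and)
open import Data.Nat.ListAction using (sum)
open import Data.List.Properties using (≡-dec)
open import Data.Integer as ℤ using (ℤ; +_; -[1+_]; ∣_∣)
open import Data.Product using (_×_; _,_)

-- All polynomials in q are represented by their evaluation maps ℕ → ℕ
-- (a polynomial identity is equivalent to equality at every q ∈ ℕ).

-- Division that returns 0 on a zero divisor (only ever used for exact
-- divisions by nonzero values, where it is ordinary division).
_div_ : ℕ → ℕ → ℕ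
a div zero    = 0
a div (suc b) = a / suc b

qint : ℕ → ℕ → ℕ
qint zero    q = 0
qint (suc j) q = suc (q * qint j q)

qfact : ℕ → ℕ → ℕ
qfact zero    q = 1
qfact (suc a) q = qint (suc a) q * qfact a q

prodFact : List ℕ → ℕ → ℕ
prodFact []       q = 1
prodFact (b ∷ bs) q = qfact b q * prodFact bs q

binomℕ : ℕ → List ℕ → ℕ → ℕ
binomℕ N β q = qfact N q div prodFact β q

nonneg : ℤ → Bool
nonneg (+ _)      = true
nonneg -[1+ _ ]   = false

binomℤ : ℕ → List ℤ → ℕ → ℕ
binomℤ N β q = if and (map nonneg β) then binomℕ N (map ∣_∣ β) q else 0

-- dec_{i+1} β  (0-based index i): decrease the entry at position i by 1
decAt : ℕ → List ℕ → List ℤ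
decAt i       []       = []
decAt zero    (x ∷ xs) = (+ x ℤ.- + 1) ∷ map +_ xs
decAt (suc i) (x ∷ xs) = + x ∷ decAt i xs

pPoly : ℕ → ℕ → List ℕ → ℕ → ℕ
pPoly n k β q = sum (map (λ i → q ^ sum (take i β) * binomℤ (n ∸ 1) (decAt i β) q) (upTo k))

bstatFrom : ℕ → List ℕ → ℕ
bstatFrom i []       = 0
bstatFrom i (x ∷ xs) = i * x + bstatFrom (suc i) xs

bstat : List ℕ → ℕ
bstat = bstatFrom 0

lastOf : {A : Set} → A → List A → A
lastOf x []       = x
lastOf x (y ∷ ys) = lastOf y ys

initOf : {A : Set} → A → List A → List A
initOf x []       = []
initOf x (y ∷ ys) = x ∷ initOf y ys

rot : {A : Set} → List A → List A
rot []       = []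
rot (x ∷ xs) = lastOf x xs ∷ initOf x xs

rotPow : {A : Set} → ℕ → List A → List A
rotPow zero    xs = xs
rotPow (suc k) xs = rot (rotPow k xs)

-- Σ_{σ ∈ C_d} q^{b(σ·α)}, where C_d = {σ_m^{k e} : 0 ≤ k < d}, e = m/d
sumCd : ℕ → ℕ → List ℕ → ℕ → ℕ
sumCd d e α q = sum (map (λ k → q ^ bstat (rotPow (k * e) α)) (upTo d))

-- [[ n ; α ]]_{q;d}  (m = number of parts, e = m/d), defined by the
-- first expression of the corollary
qbracket : ℕ → ℕ → ℕ → ℕ → List ℕ → ℕ → ℕ
qbracket n m d e α q = (sumCd d e α q * binomℕ n α (q ^ m)) div qint d (q ^ (n * e))

-- Sequences of partitions: a partition is its list of row lengths.

Partition : Set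
Partition = List ℕ

PSeq : Set
PSeq = List Partition

oneRow : List ℕ → PSeq
oneRow = map (λ a → a ∷ [])

sizes : PSeq → List ℕ
sizes = map sum

orbit : ℕ → ℕ → PSeq → List PSeq
orbit d e lam = deduplicate (≡-dec (≡-dec _≟_)) (map (λ k → rotPow (k * e) lam) (upTo d))

-- Standard tableaux of the block diagonal skew shape, encoded as words:
-- the letter at position k is the cell-row (j , r) (block j, row r of
-- λ^(j), both 0-based) containing the entry k.  A word is a standard
-- tableau iff every prefix is a lattice word within each block and the
-- final row counts are the row lengths.
Cell : Set
Cell = ℕ × ℕ

rowsFrom : ℕ → PSeq → List Cell
rowsFrom j []       = []
rowsFrom j (p ∷ ps) = map (λ r → (j , r)) (upTo (length p)) ++ rowsFrom (suc j) ps

rowsOf : PSeq → List Cell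
rowsOf = rowsFrom 0

nth : ℕ → List ℕ → ℕ
nth i       []       = 0
nth zero    (x ∷ xs) = x
nth (suc i) (x ∷ xs) = nth i xs

nthP : ℕ → PSeq → Partition
nthP i       []       = []
nthP zero    (x ∷ xs) = x
nthP (suc i) (x ∷ xs) = nthP i xs

rowLen : PSeq → Cell → ℕ
rowLen lam (j , r) = nth r (nthP j lam)

eqCell : Cell → Cell → Bool
eqCell (a , b) (c , d) = (a ≡ᵇ c) ∧ (b ≡ᵇ d)

count : Cell → List Cell → ℕ
count c []       = 0
count c (x ∷ xs) = (if eqCell c x then 1 else 0) + count c xs

words : ℕ → List Cell → List (List Cell)
words zero    cs = [] ∷ []
words (suc N) cs = concatMap (λ c → map (c ∷_) (words N cs)) cs

latticeOK : PSeq → List Cell → Bool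
latticeOK lam p = and (map (λ { (j , zero) → true
                         ; (j , suc r) → count (j , suc r) p ≤ᵇ count (j , r) p })
                      (rowsOf lam))

isSYT : PSeq → List Cell → Bool
isSYT lam w = and (map (latticeOK lam) (inits w))
            ∧ and (map (λ c → count c w ≡ᵇ rowLen lam c) (rowsOf lam))

-- (j' , r') lies in a strictly lower row than (j , r) of the block
-- diagonal shape (block 1 at the top right, block m at the bottom left)
lowerRow : Cell → Cell → Bool
lowerRow (j' , r') (j , r) = (j <ᵇ j') ∨ ((j ≡ᵇ j') ∧ (r <ᵇ r'))

majFrom : ℕ → List Cell → ℕ
majFrom k []           = 0
majFrom k (x ∷ [])     = 0
majFrom k (x ∷ y ∷ ys) = (if lowerRow y x then k else 0) + majFrom (suc k) (y ∷ ys)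

maj : List Cell → ℕ
maj = majFrom 1

totalSize : PSeq → ℕ
totalSize lam = sum (sizes lam)

sytMaj : PSeq → ℕ → ℕ
sytMaj lam q = sum (map (λ w → q ^ maj w) (filterᵇ (isSYT lam) (words (totalSize lam) (rowsOf lam))))

-- fake degree g^{{λ}^d}(q) for G(m,d,n), e = m/d, via Stembridge's formula
fakeDeg : ℕ → ℕ → ℕ → ℕ → PSeq → ℕ → ℕ
fakeDeg n m d e lam q =
  (sum (map (λ μ → q ^ bstat (sizes μ)) (orbit d e lam)) * sytMaj lam (q ^ m))
    div qint d (q ^ (n * e))

-- Identity (2), with the denominator [d]_{q^{ne}} cleared, is the heart of
-- the proof.  The q-Pascal recursion writes q^{b(γ)} binom(n; γ)_{q^m} as a
-- sum of m terms T γ i, whose first e terms form q^{b(γ)} p^{(e)}_γ(q^m), and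
-- rotating γ shifts i by one at the cost of a factor q^n.  A general cyclic
-- summation lemma for such doubly indexed families then gives (2), and (1)
-- follows by substitution.  For (3), MacMahon's theorem (the major index
-- generating function of words with content α is binom(n; α)_q) evaluates the
-- SYT polynomial of the one-row shapes ᾱ, and an orbit-counting lemma for
-- cyclic actions shows that each element of the C_d-orbit of ᾱ is visited
-- d / #orbit times by C_d, which turns the orbit sum in g into the sum in (2).
module Submission where

open import Defs
open import Data.Nat using (ℕ; zero; suc; _+_; _*_; _∸_; _^_; _≤_; _<_; z≤n; s≤s; _<ᵇ_; _≡ᵇ_; _≟_)
open import Data.Nat.Properties
open import Data.Nat.DivMod using (_%_; _/_; m*n/n≡m; m≡m%n+[m/n]*n; m%n<n)
open import Data.Nat.Divisibility using (_∣_)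
open import Data.Nat.Tactic.RingSolver using (solve-∀)
open import Data.Nat.ListAction using (sum)
open import Data.Nat.ListAction.Properties using (sum-++; sum-↭)
open import Data.Integer as ℤ using (∣_∣)
open import Data.Bool using (Bool; true; false; _∧_; _∨_; if_then_else_)
open import Data.Bool.Properties using (∧-comm; ∧-assoc; ∧-zeroʳ; ∨-identityʳ; ∧-identityʳ)
open import Data.Bool.ListAction using (and)
open import Data.List using (List; []; _∷_; _++_; _∷ʳ_; map; upTo; take; length; concatMap; inits; filterᵇ; deduplicate)
open import Data.List.Properties
  using (map-++; map-∘; map-cong; map-upTo; upTo-∷ʳ; ++-assoc; ++-identityʳ; length-++; length-map; length-upTo; ≡-dec)
open import Data.List.Membership.Propositional using (_∈_)
open import Data.List.Membership.Propositional.Properties using (∈-map⁺; ∈-map⁻; ∈-upTo⁺; ∈-upTo⁻; deduplicate-∈⇔)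
open import Data.List.Membership.Propositional.Properties.WithK using (unique∧set⇒bag)
open import Data.List.Relation.Unary.Unique.Propositional using (Unique)
open import Data.List.Relation.Unary.Unique.DecPropositional.Properties using (deduplicate-!)
import Data.List.Relation.Unary.AllPairs.Properties as AllPairs
open import Data.List.Relation.Binary.BagAndSetEquality using (∼bag⇒↭)
open import Data.List.Relation.Binary.Permutation.Propositional using (_↭_)
open import Data.List.Relation.Binary.Permutation.Propositional.Properties using (↭-length; map⁺)
open import Data.Vec using (Vec; toList)
open import Data.Vec.Properties using (length-toList)
open import Data.Product using (Σ; _×_; _,_; proj₁; proj₂)
open import Data.Sum using (_⊎_; inj₁; inj₂)
open import Data.Empty using (⊥-elim)
open import Function using (_∘_; _⇔_; mk⇔; Equivalence)
open import Relation.Nullary using (¬_; Dec; yes; no)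
open import Relation.Binary.Definitions using (DecidableEquality)
open import Relation.Binary.PropositionalEquality

Σ< : ℕ → (ℕ → ℕ) → ℕ
Σ< zero    f = 0
Σ< (suc n) f = Σ< n f + f n

sum-upTo : ∀ n (f : ℕ → ℕ) → sum (map f (upTo n)) ≡ Σ< n f
sum-upTo zero    f = refl
sum-upTo (suc n) f = begin
  sum (map f (upTo (suc n)))       ≡⟨ cong (λ l → sum (map f l)) (sym (upTo-∷ʳ n)) ⟩
  sum (map f (upTo n ++ n ∷ []))   ≡⟨ cong sum (map-++ f (upTo n) (n ∷ [])) ⟩
  sum (map f (upTo n) ++ f n ∷ []) ≡⟨ sum-++ (map f (upTo n)) (f n ∷ []) ⟩
  sum (map f (upTo n)) + (f n + 0) ≡⟨ cong₂ _+_ (sum-upTo n f) (+-identityʳ (f n)) ⟩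
  Σ< n f + f n                     ∎
  where open ≡-Reasoning

Σ-cong : ∀ n {f g : ℕ → ℕ} → (∀ i → i < n → f i ≡ g i) → Σ< n f ≡ Σ< n g
Σ-cong zero    h = refl
Σ-cong (suc n) h = cong₂ _+_ (Σ-cong n (λ i i<n → h i (m<n⇒m<1+n i<n))) (h n ≤-refl)

Σ-ext : ∀ n {f g : ℕ → ℕ} → (∀ i → f i ≡ g i) → Σ< n f ≡ Σ< n g
Σ-ext n h = Σ-cong n (λ i _ → h i)

Σ-zero : ∀ n → Σ< n (λ _ → 0) ≡ 0
Σ-zero zero    = refl
Σ-zero (suc n) = cong (_+ 0) (Σ-zero n)

Σ-+ : ∀ n (f g : ℕ → ℕ) → Σ< n (λ i → f i + g i) ≡ Σ< n f + Σ< n g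
Σ-+ zero    f g = refl
Σ-+ (suc n) f g = begin
  Σ< n (λ i → f i + g i) + (f n + g n) ≡⟨ cong (_+ (f n + g n)) (Σ-+ n f g) ⟩
  Σ< n f + Σ< n g + (f n + g n)        ≡⟨ interchange (Σ< n f) (Σ< n g) (f n) (g n) ⟩
  Σ< n f + f n + (Σ< n g + g n)        ∎
  where open ≡-Reasoning
        interchange : ∀ a b c d → a + b + (c + d) ≡ a + c + (b + d)
        interchange = solve-∀

Σ-*ˡ : ∀ n c (f : ℕ → ℕ) → c * Σ< n f ≡ Σ< n (λ i → c * f i)
Σ-*ˡ zero    c f = *-zeroʳ c
Σ-*ˡ (suc n) c f = trans (*-distribˡ-+ c (Σ< n f) (f n)) (cong (_+ c * f n) (Σ-*ˡ n c f))

Σ-*ʳ : ∀ n c (f : ℕ → ℕ) → Σ< n f * c ≡ Σ< n (λ i → f i * c)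
Σ-*ʳ n c f = trans (*-comm (Σ< n f) c) (trans (Σ-*ˡ n c f) (Σ-ext n (λ i → *-comm c (f i))))

Σ-head : ∀ n (f : ℕ → ℕ) → Σ< (suc n) f ≡ f 0 + Σ< n (λ i → f (suc i))
Σ-head zero    f = +-comm 0 (f 0)
Σ-head (suc n) f = trans (cong (_+ f (suc n)) (Σ-head n f)) (+-assoc (f 0) _ _)

Σ-split : ∀ a b (f : ℕ → ℕ) → Σ< (a + b) f ≡ Σ< a f + Σ< b (λ i → f (a + i))
Σ-split a zero    f = trans (cong (λ k → Σ< k f) (+-identityʳ a)) (sym (+-identityʳ _))
Σ-split a (suc b) f = begin
  Σ< (a + suc b) f                            ≡⟨ cong (λ k → Σ< k f) (+-suc a b) ⟩
  Σ< (a + b) f + f (a + b)                    ≡⟨ cong (_+ f (a + b)) (Σ-split a b f) ⟩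
  Σ< a f + Σ< b (λ i → f (a + i)) + f (a + b) ≡⟨ +-assoc (Σ< a f) _ _ ⟩
  Σ< a f + Σ< (suc b) (λ i → f (a + i))       ∎
  where open ≡-Reasoning

Σ-swap : ∀ a b (f : ℕ → ℕ → ℕ) →
         Σ< a (λ i → Σ< b (λ j → f i j)) ≡ Σ< b (λ j → Σ< a (λ i → f i j))
Σ-swap zero    b f = sym (Σ-zero b)
Σ-swap (suc a) b f = begin
  Σ< a (λ i → Σ< b (f i)) + Σ< b (f a)      ≡⟨ cong (_+ Σ< b (f a)) (Σ-swap a b f) ⟩
  Σ< b (λ j → Σ< a (λ i → f i j)) + Σ< b (f a) ≡⟨ sym (Σ-+ b _ _) ⟩
  Σ< b (λ j → Σ< (suc a) (λ i → f i j))     ∎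
  where open ≡-Reasoning

Σ-blocks : ∀ d e (f : ℕ → ℕ) → Σ< (d * e) f ≡ Σ< d (λ l → Σ< e (λ i → f (l * e + i)))
Σ-blocks zero    e f = refl
Σ-blocks (suc d) e f = begin
  Σ< (suc d * e) f                          ≡⟨ cong (λ k → Σ< k f) (+-comm e (d * e)) ⟩
  Σ< (d * e + e) f                          ≡⟨ Σ-split (d * e) e f ⟩
  Σ< (d * e) f + Σ< e (λ i → f (d * e + i)) ≡⟨ cong (_+ Σ< e (λ i → f (d * e + i))) (Σ-blocks d e f) ⟩
  Σ< (suc d) (λ l → Σ< e (λ i → f (l * e + i))) ∎
  where open ≡-Reasoning

-- Moving a window of length d one step to the right replaces V s by
-- V (s + d), which is V s again when V is d-periodic.
Σ-slide : ∀ d (V : ℕ → ℕ) → (∀ k → V (k + d) ≡ V k) →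
          ∀ s → Σ< d (λ k → V (k + suc s)) ≡ Σ< d (λ k → V (k + s))
Σ-slide zero     V per s = refl
Σ-slide (suc d') V per s = begin
  Σ< (suc d') (λ k → V (k + suc s))            ≡⟨ Σ-ext (suc d') (λ k → cong V (+-suc k s)) ⟩
  Σ< d' (λ k → V (suc k + s)) + V (suc d' + s)
    ≡⟨ cong (Σ< d' (λ k → V (suc k + s)) +_) (trans (cong V (+-comm (suc d') s)) (per s)) ⟩
  Σ< d' (λ k → V (suc k + s)) + V s            ≡⟨ +-comm _ (V s) ⟩
  V s + Σ< d' (λ k → V (suc k + s))            ≡⟨ sym (Σ-head d' (λ k → V (k + s))) ⟩
  Σ< (suc d') (λ k → V (k + s))                ∎
  where open ≡-Reasoning

Σ-window : ∀ d (V : ℕ → ℕ) → (∀ k → V (k + d) ≡ V k) →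
           ∀ s → Σ< d (λ k → V (k + s)) ≡ Σ< d V
Σ-window d V per zero    = Σ-ext d (λ k → cong V (+-identityʳ k))
Σ-window d V per (suc s) = trans (Σ-slide d V per s) (Σ-window d V per s)

Σ-periodic : ∀ L t (V : ℕ → ℕ) → (∀ k → V (k + L) ≡ V k) → Σ< (t * L) V ≡ t * Σ< L V
Σ-periodic L zero    V per = refl
Σ-periodic L (suc t) V per = begin
  Σ< (L + t * L) V                       ≡⟨ Σ-split L (t * L) V ⟩
  Σ< L V + Σ< (t * L) (λ i → V (L + i))  ≡⟨ cong (Σ< L V +_) (Σ-ext (t * L) (λ i → trans (cong V (+-comm L i)) (per i))) ⟩
  Σ< L V + Σ< (t * L) V                  ≡⟨ cong (Σ< L V +_) (Σ-periodic L t V per) ⟩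
  Σ< L V + t * Σ< L V                    ∎
  where open ≡-Reasoning

qint-geometric : ∀ d x → qint d x ≡ Σ< d (x ^_)
qint-geometric zero    x = refl
qint-geometric (suc d) x = begin
  suc (x * qint d x)          ≡⟨ cong (λ t → suc (x * t)) (qint-geometric d x) ⟩
  1 + x * Σ< d (x ^_)         ≡⟨ cong (1 +_) (Σ-*ˡ d x (x ^_)) ⟩
  1 + Σ< d (λ l → x * x ^ l)  ≡⟨ sym (Σ-head d (x ^_)) ⟩
  Σ< (suc d) (x ^_)           ∎
  where open ≡-Reasoning

qint-+ : ∀ a b Q → qint (a + b) Q ≡ qint a Q + Q ^ a * qint b Q
qint-+ zero    b Q = sym (+-identityʳ _)
qint-+ (suc a) b Q = cong suc (begin
  Q * qint (a + b) Q                ≡⟨ cong (Q *_) (qint-+ a b Q) ⟩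
  Q * (qint a Q + Q ^ a * qint b Q) ≡⟨ distrib Q (qint a Q) (Q ^ a) (qint b Q) ⟩
  Q * qint a Q + Q * Q ^ a * qint b Q ∎)
  where open ≡-Reasoning
        distrib : ∀ q x y z → q * (x + y * z) ≡ q * x + q * y * z
        distrib = solve-∀

-- q-factorials never vanish, so the divisions in Defs are by positive numbers.
qfact-pos : ∀ a Q → 1 ≤ qfact a Q
qfact-pos zero    Q = ≤-refl
qfact-pos (suc a) Q = *-mono-≤ {1} {qint (suc a) Q} (s≤s z≤n) (qfact-pos a Q)

prodFact-pos : ∀ β Q → 1 ≤ prodFact β Q
prodFact-pos []       Q = ≤-refl
prodFact-pos (x ∷ xs) Q = *-mono-≤ (qfact-pos x Q) (prodFact-pos xs Q)

div-exact : ∀ a b c → 1 ≤ b → a ≡ c * b → a div b ≡ c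
div-exact a (suc b) c _ refl = m*n/n≡m c (suc b)

*-cancelʳ-pos : ∀ b x y → 1 ≤ b → x * b ≡ y * b → x ≡ y
*-cancelʳ-pos (suc b) x y _ = *-cancelʳ-≡ x y (suc b)

pre : ℕ → List ℕ → ℕ
pre i β = sum (take i β)

decℕ : ℕ → List ℕ → List ℕ
decℕ i       []       = []
decℕ zero    (x ∷ xs) = (x ∸ 1) ∷ xs
decℕ (suc i) (x ∷ xs) = x ∷ decℕ i xs

pre-suc : ∀ i β → pre (suc i) β ≡ pre i β + nth i β
pre-suc zero    []       = refl
pre-suc (suc i) []       = refl
pre-suc zero    (x ∷ xs) = +-identityʳ x
pre-suc (suc i) (x ∷ xs) = trans (cong (x +_) (pre-suc i xs)) (sym (+-assoc x _ _))

pre-all : ∀ i β → length β ≤ i → pre i β ≡ sum β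
pre-all zero    []       _       = refl
pre-all (suc i) []       _       = refl
pre-all (suc i) (x ∷ xs) (s≤s h) = cong (x +_) (pre-all i xs h)

pre-≤ : ∀ i β → pre i β ≤ sum β
pre-≤ zero    β        = z≤n
pre-≤ (suc i) []       = z≤n
pre-≤ (suc i) (x ∷ β)  = +-monoʳ-≤ x (pre-≤ i β)

pre-dec : ∀ i j β → i ≤ j → pre i (decℕ j β) ≡ pre i β
pre-dec zero    j       β        _       = refl
pre-dec (suc i) j       []       _       = refl
pre-dec (suc i) (suc j) (x ∷ xs) (s≤s h) = cong (x +_) (pre-dec i j xs h)

sum-dec : ∀ i β → 1 ≤ nth i β → suc (sum (decℕ i β)) ≡ sum β
sum-dec zero    (suc x ∷ xs) _ = refl
sum-dec (suc i) (x ∷ xs)     h = trans (sym (+-suc x _)) (cong (x +_) (sum-dec i xs h))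

length-dec : ∀ i β → length (decℕ i β) ≡ length β
length-dec i       []       = refl
length-dec zero    (x ∷ xs) = refl
length-dec (suc i) (x ∷ xs) = cong suc (length-dec i xs)

nth-dec-≢ : ∀ i j β → i ≢ j → nth i (decℕ j β) ≡ nth i β
nth-dec-≢ i       j       []       _  = refl
nth-dec-≢ zero    zero    (x ∷ xs) ne = ⊥-elim (ne refl)
nth-dec-≢ zero    (suc j) (x ∷ xs) ne = refl
nth-dec-≢ (suc i) zero    (x ∷ xs) ne = refl
nth-dec-≢ (suc i) (suc j) (x ∷ xs) ne = nth-dec-≢ i j xs (λ e → ne (cong suc e))

nth-dec-≡ : ∀ j β → nth j (decℕ j β) ≡ nth j β ∸ 1
nth-dec-≡ j       []       = refl
nth-dec-≡ zero    (x ∷ xs) = refl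
nth-dec-≡ (suc j) (x ∷ xs) = nth-dec-≡ j xs

decAt-nat : ∀ i β → 1 ≤ nth i β → decAt i β ≡ map ℤ.+_ (decℕ i β)
decAt-nat zero    (suc x ∷ xs) _ = refl
decAt-nat (suc i) (x ∷ xs)     h = cong (ℤ.+ x ∷_) (decAt-nat i xs h)

all-nonneg : ∀ xs → and (map nonneg (map ℤ.+_ xs)) ≡ true
all-nonneg []       = refl
all-nonneg (x ∷ xs) = all-nonneg xs

abs-nat : ∀ xs → map ∣_∣ (map ℤ.+_ xs) ≡ xs
abs-nat []       = refl
abs-nat (x ∷ xs) = cong (x ∷_) (abs-nat xs)

decAt-negative : ∀ i β → i < length β → nth i β ≡ 0 → and (map nonneg (decAt i β)) ≡ false
decAt-negative zero    (zero ∷ xs) _       _ = refl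
decAt-negative (suc i) (x ∷ xs)    (s≤s h) e = decAt-negative i xs h e

binomℤ-pos : ∀ N i β Q → 1 ≤ nth i β → binomℤ N (decAt i β) Q ≡ binomℕ N (decℕ i β) Q
binomℤ-pos N i β Q h rewrite decAt-nat i β h | all-nonneg (decℕ i β) | abs-nat (decℕ i β) = refl

binomℤ-zero : ∀ N i β Q → i < length β → nth i β ≡ 0 → binomℤ N (decAt i β) Q ≡ 0
binomℤ-zero N i β Q h e rewrite decAt-negative i β h e = refl

prodFact-dec : ∀ i β Q → 1 ≤ nth i β → prodFact β Q ≡ qint (nth i β) Q * prodFact (decℕ i β) Q
prodFact-dec zero    (suc x ∷ xs) Q _ = *-assoc (qint (suc x) Q) (qfact x Q) (prodFact xs Q)
prodFact-dec (suc i) (x ∷ xs)     Q h = begin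
  qfact x Q * prodFact xs Q                                ≡⟨ cong (qfact x Q *_) (prodFact-dec i xs Q h) ⟩
  qfact x Q * (qint (nth i xs) Q * prodFact (decℕ i xs) Q) ≡⟨ *-left-comm (qfact x Q) (qint (nth i xs) Q) (prodFact (decℕ i xs) Q) ⟩
  qint (nth i xs) Q * (qfact x Q * prodFact (decℕ i xs) Q) ∎
  where open ≡-Reasoning
        *-left-comm : ∀ a b c → a * (b * c) ≡ b * (a * c)
        *-left-comm = solve-∀

prodFact-zero : ∀ β Q → sum β ≡ 0 → prodFact β Q ≡ 1
prodFact-zero []          Q _ = refl
prodFact-zero (zero ∷ xs) Q e = trans (+-identityʳ _) (prodFact-zero xs Q e)

Σ-qint : ∀ j β Q → Σ< j (λ i → Q ^ pre i β * qint (nth i β) Q) ≡ qint (pre j β) Q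
Σ-qint zero    β Q = refl
Σ-qint (suc j) β Q = begin
  Σ< j (λ i → Q ^ pre i β * qint (nth i β) Q) + Q ^ pre j β * qint (nth j β) Q
     ≡⟨ cong (_+ Q ^ pre j β * qint (nth j β) Q) (Σ-qint j β Q) ⟩
  qint (pre j β) Q + Q ^ pre j β * qint (nth j β) Q ≡⟨ sym (qint-+ (pre j β) (nth j β) Q) ⟩
  qint (pre j β + nth j β) Q                        ≡⟨ cong (λ t → qint t Q) (sym (pre-suc j β)) ⟩
  qint (pre (suc j) β) Q                            ∎
  where open ≡-Reasoning

Σ-qint-all : ∀ β Q → Σ< (length β) (λ i → Q ^ pre i β * qint (nth i β) Q) ≡ qint (sum β) Q
Σ-qint-all β Q = trans (Σ-qint (length β) β Q) (cong (λ t → qint t Q) (pre-all (length β) β ≤-refl))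

-- q-Pascal recursion for q-multinomials: for a composition β of n + 1,
--   binom(n+1; β)_Q = Σ_i Q^{β_0+⋯+β_{i-1}} binom(n; dec_i β)_Q,
-- proved simultaneously with the integrality statement
-- binom(N; β)_Q · Π [βⱼ]_Q! = [N]_Q!, which makes every division exact.
module QMultinomial (Q : ℕ) where

  pascalTerm : ℕ → List ℕ → ℕ → ℕ
  pascalTerm n β i = Q ^ pre i β * binomℤ n (decAt i β) Q

  mutual
    binom-integral : ∀ N β → sum β ≡ N → binomℕ N β Q * prodFact β Q ≡ qfact N Q
    binom-integral zero    β e rewrite prodFact-zero β Q e = refl
    binom-integral (suc n) β e = begin
      binomℕ (suc n) β Q * prodFact β Q                    ≡⟨ cong (_* prodFact β Q) (binom-pascal n β e) ⟩
      Σ< (length β) (pascalTerm n β) * prodFact β Q        ≡⟨ sym (pascal-cleared n β e) ⟩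
      qfact (suc n) Q                                      ∎
      where open ≡-Reasoning

    pascalTerm-cleared : ∀ n β i → sum β ≡ suc n → i < length β →
      pascalTerm n β i * prodFact β Q ≡ Q ^ pre i β * qint (nth i β) Q * qfact n Q
    pascalTerm-cleared n β i e il with nth i β in eq
    ... | zero  rewrite binomℤ-zero n i β Q il eq | *-zeroʳ (Q ^ pre i β) = refl
    ... | suc x = begin
      Q ^ pre i β * binomℤ n (decAt i β) Q * prodFact β Q
        ≡⟨ cong₂ (λ b p → Q ^ pre i β * b * p) (binomℤ-pos n i β Q βᵢ≥1) (prodFact-dec i β Q βᵢ≥1) ⟩
      Q ^ pre i β * B * (qint (nth i β) Q * prodFact (decℕ i β) Q)
        ≡⟨ cong (λ t → Q ^ pre i β * B * (qint t Q * prodFact (decℕ i β) Q)) eq ⟩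
      Q ^ pre i β * B * (qint (suc x) Q * prodFact (decℕ i β) Q)
        ≡⟨ middle-swap (Q ^ pre i β) B (qint (suc x) Q) (prodFact (decℕ i β) Q) ⟩
      Q ^ pre i β * qint (suc x) Q * (B * prodFact (decℕ i β) Q)
        ≡⟨ cong (Q ^ pre i β * qint (suc x) Q *_) (binom-integral n (decℕ i β) sum-decℕ) ⟩
      Q ^ pre i β * qint (suc x) Q * qfact n Q ∎
      where open ≡-Reasoning
            βᵢ≥1 : 1 ≤ nth i β
            βᵢ≥1 = subst (1 ≤_) (sym eq) (s≤s z≤n)
            B : ℕ
            B = binomℕ n (decℕ i β) Q
            sum-decℕ : sum (decℕ i β) ≡ n
            sum-decℕ = suc-injective (trans (sum-dec i β βᵢ≥1) e)
            middle-swap : ∀ a b c d → a * b * (c * d) ≡ a * c * (b * d)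
            middle-swap = solve-∀

    -- Summing the cleared terms gives [sum β]_Q [n]_Q! = [n+1]_Q!.
    pascal-cleared : ∀ n β → sum β ≡ suc n → qfact (suc n) Q ≡ Σ< (length β) (pascalTerm n β) * prodFact β Q
    pascal-cleared n β e = begin
      qint (suc n) Q * qfact n Q  ≡⟨ cong (λ t → qint t Q * qfact n Q) (sym e) ⟩
      qint (sum β) Q * qfact n Q  ≡⟨ cong (_* qfact n Q) (sym (Σ-qint-all β Q)) ⟩
      Σ< (length β) (λ i → Q ^ pre i β * qint (nth i β) Q) * qfact n Q
        ≡⟨ Σ-*ʳ (length β) (qfact n Q) _ ⟩
      Σ< (length β) (λ i → Q ^ pre i β * qint (nth i β) Q * qfact n Q)
        ≡⟨ Σ-cong (length β) (λ i il → sym (pascalTerm-cleared n β i e il)) ⟩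
      Σ< (length β) (λ i → pascalTerm n β i * prodFact β Q) ≡⟨ sym (Σ-*ʳ (length β) (prodFact β Q) _) ⟩
      Σ< (length β) (pascalTerm n β) * prodFact β Q ∎
      where open ≡-Reasoning

    binom-pascal : ∀ n β → sum β ≡ suc n → binomℕ (suc n) β Q ≡ Σ< (length β) (pascalTerm n β)
    binom-pascal n β e = div-exact _ _ _ (prodFact-pos β Q) (pascal-cleared n β e)

-- The cyclic summation lemma behind the first two identities.
-- Cutting the inner sum into d blocks of length e, block l of row k equals
-- c^{l e} V(k + d - l), and V is d-periodic, so each block sums to Σ V.
module CyclicSum (U : ℕ → ℕ → ℕ) (m d e c : ℕ) (m≡de : m ≡ d * e)
                 (periodic : ∀ k i → U (k + m) i ≡ U k i)
                 (shift : ∀ k i → suc i < m → U (suc k) (suc i) ≡ c * U k i) where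

  shift-iter : ∀ t j i → t + i < m → U (t + j) (t + i) ≡ c ^ t * U j i
  shift-iter zero    j i _ = sym (+-identityʳ _)
  shift-iter (suc t) j i h = begin
    U (suc (t + j)) (suc (t + i)) ≡⟨ shift (t + j) (t + i) h ⟩
    c * U (t + j) (t + i)         ≡⟨ cong (c *_) (shift-iter t j i (<-trans (n<1+n (t + i)) h)) ⟩
    c * (c ^ t * U j i)           ≡⟨ sym (*-assoc c _ _) ⟩
    c ^ suc t * U j i             ∎
    where open ≡-Reasoning

  V : ℕ → ℕ
  V k = Σ< e (λ i → U (k * e) i)

  V-periodic : ∀ k → V (k + d) ≡ V k
  V-periodic k = Σ-ext e (λ i → trans (cong (λ t → U t i) shifted) (periodic (k * e) i))
    where shifted : (k + d) * e ≡ k * e + m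
          shifted = trans (*-distribʳ-+ e k d) (cong (k * e +_) (sym m≡de))

  block-index< : ∀ l i → l < d → i < e → l * e + i < m
  block-index< l i l<d i<e = subst (l * e + i <_) (sym m≡de) (begin-strict
      l * e + i <⟨ +-monoʳ-< (l * e) i<e ⟩
      l * e + e ≡⟨ +-comm (l * e) e ⟩
      suc l * e ≤⟨ *-monoˡ-≤ e l<d ⟩
      d * e     ∎)
    where open ≤-Reasoning

  block-entry : ∀ k l i → l < d → i < e →
                U (k * e) (l * e + i) ≡ c ^ (l * e) * U ((k + (d ∸ l)) * e) i
  block-entry k l i l<d i<e = begin
    U (k * e) (l * e + i)                     ≡⟨ sym (periodic (k * e) (l * e + i)) ⟩
    U (k * e + m) (l * e + i)                 ≡⟨ cong (λ t → U t (l * e + i)) row-index ⟩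
    U (l * e + (k + (d ∸ l)) * e) (l * e + i) ≡⟨ shift-iter (l * e) _ i (block-index< l i l<d i<e) ⟩
    c ^ (l * e) * U ((k + (d ∸ l)) * e) i     ∎
    where
      open ≡-Reasoning
      regroup : ∀ k l x e → k * e + (l + x) * e ≡ l * e + (k + x) * e
      regroup = solve-∀
      row-index : k * e + m ≡ l * e + (k + (d ∸ l)) * e
      row-index = begin
        k * e + m                 ≡⟨ cong (k * e +_) m≡de ⟩
        k * e + d * e             ≡⟨ cong (λ t → k * e + t * e) (sym (m+[n∸m]≡n (<⇒≤ l<d))) ⟩
        k * e + (l + (d ∸ l)) * e ≡⟨ regroup k l (d ∸ l) e ⟩
        l * e + (k + (d ∸ l)) * e ∎

  row-blocks : ∀ k → k < d → Σ< m (λ i → U (k * e) i) ≡ Σ< d (λ l → c ^ (l * e) * V (k + (d ∸ l)))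
  row-blocks k k<d = begin
    Σ< m (λ i → U (k * e) i)                           ≡⟨ cong (λ t → Σ< t (λ i → U (k * e) i)) m≡de ⟩
    Σ< (d * e) (λ i → U (k * e) i)                     ≡⟨ Σ-blocks d e _ ⟩
    Σ< d (λ l → Σ< e (λ i → U (k * e) (l * e + i)))
      ≡⟨ Σ-cong d (λ l l<d → Σ-cong e (λ i i<e → block-entry k l i l<d i<e)) ⟩
    Σ< d (λ l → Σ< e (λ i → c ^ (l * e) * U ((k + (d ∸ l)) * e) i))
      ≡⟨ Σ-ext d (λ l → sym (Σ-*ˡ e (c ^ (l * e)) _)) ⟩
    Σ< d (λ l → c ^ (l * e) * V (k + (d ∸ l)))         ∎
    where open ≡-Reasoning

  cyclic-sum : qint d (c ^ e) * Σ< d V ≡ Σ< d (λ k → Σ< m (λ i → U (k * e) i))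
  cyclic-sum = sym (begin
    Σ< d (λ k → Σ< m (λ i → U (k * e) i))                        ≡⟨ Σ-cong d row-blocks ⟩
    Σ< d (λ k → Σ< d (λ l → c ^ (l * e) * V (k + (d ∸ l))))      ≡⟨ Σ-swap d d _ ⟩
    Σ< d (λ l → Σ< d (λ k → c ^ (l * e) * V (k + (d ∸ l))))
      ≡⟨ Σ-ext d (λ l → sym (Σ-*ˡ d (c ^ (l * e)) (λ k → V (k + (d ∸ l))))) ⟩
    Σ< d (λ l → c ^ (l * e) * Σ< d (λ k → V (k + (d ∸ l))))
      ≡⟨ Σ-ext d (λ l → cong₂ _*_ (power l) (Σ-window d V V-periodic (d ∸ l))) ⟩
    Σ< d (λ l → (c ^ e) ^ l * Σ< d V)                            ≡⟨ sym (Σ-*ʳ d (Σ< d V) ((c ^ e) ^_)) ⟩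
    Σ< d ((c ^ e) ^_) * Σ< d V                                    ≡⟨ cong (_* Σ< d V) (sym (qint-geometric d (c ^ e))) ⟩
    qint d (c ^ e) * Σ< d V                                       ∎)
    where open ≡-Reasoning
          power : ∀ l → c ^ (l * e) ≡ (c ^ e) ^ l
          power l = trans (cong (c ^_) (*-comm l e)) (sym (^-*-assoc c e l))

-- Rotations.  `rot` moves the last entry to the front; every nonempty list
-- is `initOf x xs ++ [lastOf x xs]`, which reduces facts about `rot` to the
-- equation rot (xs ++ [y]) = y ∷ xs.
snoc-view : {A : Set} (x : A) (xs : List A) → x ∷ xs ≡ initOf x xs ++ lastOf x xs ∷ []
snoc-view x []       = refl
snoc-view x (y ∷ xs) = cong (x ∷_) (snoc-view y xs)

lastOf-snoc : {A : Set} (x : A) (ys : List A) (y : A) → lastOf x (ys ++ y ∷ []) ≡ y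
lastOf-snoc x []       y = refl
lastOf-snoc x (z ∷ ys) y = lastOf-snoc z ys y

initOf-snoc : {A : Set} (x : A) (ys : List A) (y : A) → initOf x (ys ++ y ∷ []) ≡ x ∷ ys
initOf-snoc x []       y = refl
initOf-snoc x (z ∷ ys) y = cong (x ∷_) (initOf-snoc z ys y)

rot-snoc : {A : Set} (xs : List A) (y : A) → rot (xs ++ y ∷ []) ≡ y ∷ xs
rot-snoc []       y = refl
rot-snoc (x ∷ xs) y = cong₂ _∷_ (lastOf-snoc x xs y) (initOf-snoc x xs y)

rotPow-+ : {A : Set} (k j : ℕ) (xs : List A) → rotPow (k + j) xs ≡ rotPow k (rotPow j xs)
rotPow-+ zero    j xs = refl
rotPow-+ (suc k) j xs = cong rot (rotPow-+ k j xs)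

-- The left rotation undoes `rot`; rotating a list of length m left m times
-- is the identity, hence so is rotating it right m times.
rotL : {A : Set} → List A → List A
rotL []       = []
rotL (x ∷ xs) = xs ++ x ∷ []

rotLPow : {A : Set} → ℕ → List A → List A
rotLPow zero    xs = xs
rotLPow (suc k) xs = rotLPow k (rotL xs)

rotPow-rotLPow : {A : Set} (k : ℕ) (xs : List A) → rotPow k (rotLPow k xs) ≡ xs
rotPow-rotLPow zero    xs       = refl
rotPow-rotLPow (suc k) []       = cong rot (rotPow-rotLPow k [])
rotPow-rotLPow (suc k) (x ∷ xs) = trans (cong rot (rotPow-rotLPow k (xs ++ x ∷ []))) (rot-snoc xs x)

rotLPow-++ : {A : Set} (ys zs : List A) → rotLPow (length ys) (ys ++ zs) ≡ zs ++ ys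
rotLPow-++ []       zs = sym (++-identityʳ zs)
rotLPow-++ (y ∷ ys) zs = begin
  rotLPow (length ys) ((ys ++ zs) ++ y ∷ []) ≡⟨ cong (rotLPow (length ys)) (++-assoc ys zs (y ∷ [])) ⟩
  rotLPow (length ys) (ys ++ zs ++ y ∷ [])   ≡⟨ rotLPow-++ ys (zs ++ y ∷ []) ⟩
  (zs ++ y ∷ []) ++ ys                       ≡⟨ ++-assoc zs (y ∷ []) ys ⟩
  zs ++ y ∷ ys                               ∎
  where open ≡-Reasoning

rotPow-length : {A : Set} (xs : List A) → rotPow (length xs) xs ≡ xs
rotPow-length xs = begin
  rotPow (length xs) xs                              ≡⟨ cong (rotPow (length xs)) (sym (rotLPow-++ xs [])) ⟩
  rotPow (length xs) (rotLPow (length xs) (xs ++ [])) ≡⟨ rotPow-rotLPow (length xs) (xs ++ []) ⟩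
  xs ++ []                                           ≡⟨ ++-identityʳ xs ⟩
  xs                                                 ∎
  where open ≡-Reasoning

map-rotPow : {A B : Set} (f : A → B) (k : ℕ) (xs : List A) → map f (rotPow k xs) ≡ rotPow k (map f xs)
map-rotPow f zero    xs = refl
map-rotPow f (suc k) xs = trans (map-rot (rotPow k xs)) (cong rot (map-rotPow f k xs))
  where
    lastOf-map : ∀ x xs → f (lastOf x xs) ≡ lastOf (f x) (map f xs)
    lastOf-map x []       = refl
    lastOf-map x (y ∷ xs) = lastOf-map y xs
    initOf-map : ∀ x xs → map f (initOf x xs) ≡ initOf (f x) (map f xs)
    initOf-map x []       = refl
    initOf-map x (y ∷ xs) = cong (f x ∷_) (initOf-map y xs)
    map-rot : ∀ xs → map f (rot xs) ≡ rot (map f xs)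
    map-rot []       = refl
    map-rot (x ∷ xs) = cong₂ _∷_ (lastOf-map x xs) (initOf-map x xs)

rotPow-invariant : {A B : Set} (f : List A → B) → (∀ xs y → f (y ∷ xs) ≡ f (xs ++ y ∷ [])) →
                   ∀ k xs → f (rotPow k xs) ≡ f xs
rotPow-invariant f h zero    xs = refl
rotPow-invariant f h (suc k) xs = trans (rot-invariant (rotPow k xs)) (rotPow-invariant f h k xs)
  where
    rot-invariant : ∀ xs → f (rot xs) ≡ f xs
    rot-invariant []       = refl
    rot-invariant (x ∷ xs) = trans (h (initOf x xs) (lastOf x xs)) (cong f (sym (snoc-view x xs)))

length-snoc : {A : Set} (xs : List A) (y : A) → length (y ∷ xs) ≡ length (xs ++ y ∷ [])
length-snoc xs y = trans (+-comm 1 (length xs)) (sym (length-++ xs))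

sum-snoc : ∀ xs y → sum (y ∷ xs) ≡ sum (xs ++ y ∷ [])
sum-snoc xs y = begin
  y + sum xs          ≡⟨ +-comm y (sum xs) ⟩
  sum xs + y          ≡⟨ cong (sum xs +_) (sym (+-identityʳ y)) ⟩
  sum xs + sum (y ∷ []) ≡⟨ sym (sum-++ xs (y ∷ [])) ⟩
  sum (xs ++ y ∷ [])  ∎
  where open ≡-Reasoning

prodFact-snoc : ∀ Q xs y → prodFact (y ∷ xs) Q ≡ prodFact (xs ++ y ∷ []) Q
prodFact-snoc Q []       y = refl
prodFact-snoc Q (x ∷ xs) y = begin
  qfact y Q * (qfact x Q * prodFact xs Q) ≡⟨ *-left-comm (qfact y Q) (qfact x Q) (prodFact xs Q) ⟩
  qfact x Q * (qfact y Q * prodFact xs Q) ≡⟨ cong (qfact x Q *_) (prodFact-snoc Q xs y) ⟩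
  qfact x Q * prodFact (xs ++ y ∷ []) Q   ∎
  where open ≡-Reasoning
        *-left-comm : ∀ a b c → a * (b * c) ≡ b * (a * c)
        *-left-comm = solve-∀

and-snoc : {A : Set} (f : A → Bool) (xs : List A) (y : A) → and (map f (y ∷ xs)) ≡ and (map f (xs ++ y ∷ []))
and-snoc f []       y = refl
and-snoc f (x ∷ xs) y = begin
  f y ∧ (f x ∧ and (map f xs)) ≡⟨ sym (∧-assoc (f y) (f x) _) ⟩
  (f y ∧ f x) ∧ and (map f xs) ≡⟨ cong (_∧ and (map f xs)) (∧-comm (f y) (f x)) ⟩
  (f x ∧ f y) ∧ and (map f xs) ≡⟨ ∧-assoc (f x) (f y) _ ⟩
  f x ∧ (f y ∧ and (map f xs)) ≡⟨ cong (f x ∧_) (and-snoc f xs y) ⟩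
  f x ∧ and (map f (xs ++ y ∷ [])) ∎
  where open ≡-Reasoning

binomℤ-snoc : ∀ N Q xs y → binomℤ N (y ∷ xs) Q ≡ binomℤ N (xs ++ y ∷ []) Q
binomℤ-snoc N Q xs y rewrite and-snoc nonneg xs y | map-++ ∣_∣ xs (y ∷ [])
  | prodFact-snoc Q (map ∣_∣ xs) ∣ y ∣ = refl

binomℕ-rotPow : ∀ N Q k xs → binomℕ N (rotPow k xs) Q ≡ binomℕ N xs Q
binomℕ-rotPow N Q = rotPow-invariant (λ l → binomℕ N l Q) (λ l y → cong (qfact N Q div_) (prodFact-snoc Q l y))

bstatFrom-suc : ∀ k xs → bstatFrom (suc k) xs ≡ sum xs + bstatFrom k xs
bstatFrom-suc k []       = refl
bstatFrom-suc k (x ∷ xs) = begin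
  suc k * x + bstatFrom (suc (suc k)) xs      ≡⟨ cong (suc k * x +_) (bstatFrom-suc (suc k) xs) ⟩
  suc k * x + (sum xs + bstatFrom (suc k) xs) ≡⟨ regroup k x (sum xs) (bstatFrom (suc k) xs) ⟩
  x + sum xs + (k * x + bstatFrom (suc k) xs) ∎
  where open ≡-Reasoning
        regroup : ∀ k x s b → suc k * x + (s + b) ≡ x + s + (k * x + b)
        regroup = solve-∀

bstatFrom-snoc : ∀ k xs y → bstatFrom k (xs ++ y ∷ []) ≡ bstatFrom k xs + (k + length xs) * y
bstatFrom-snoc k []       y = trans (+-identityʳ _) (cong (_* y) (sym (+-identityʳ k)))
bstatFrom-snoc k (x ∷ xs) y = begin
  k * x + bstatFrom (suc k) (xs ++ y ∷ [])                  ≡⟨ cong (k * x +_) (bstatFrom-snoc (suc k) xs y) ⟩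
  k * x + (bstatFrom (suc k) xs + (suc k + length xs) * y)  ≡⟨ sym (+-assoc (k * x) _ _) ⟩
  k * x + bstatFrom (suc k) xs + (suc k + length xs) * y
    ≡⟨ cong (λ t → k * x + bstatFrom (suc k) xs + t * y) (sym (+-suc k (length xs))) ⟩
  k * x + bstatFrom (suc k) xs + (k + suc (length xs)) * y  ∎
  where open ≡-Reasoning

pre-snoc : ∀ i xs y → i ≤ length xs → pre i (xs ++ y ∷ []) ≡ pre i xs
pre-snoc zero    xs       y _       = refl
pre-snoc (suc i) (x ∷ xs) y (s≤s h) = cong (x +_) (pre-snoc i xs y h)

decAt-snoc : ∀ i xs y → i < length xs → decAt i (xs ++ y ∷ []) ≡ decAt i xs ++ ℤ.+ y ∷ []
decAt-snoc zero    (x ∷ xs) y _       = cong ((ℤ.+ x ℤ.- ℤ.+ 1) ∷_) (map-++ ℤ.+_ xs (y ∷ []))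
decAt-snoc (suc i) (x ∷ xs) y (s≤s h) = cong (ℤ.+ x ∷_) (decAt-snoc i xs y h)

-- For compositions γ of n = n' + 1 with m parts, the weighted Pascal terms
--   T γ i = q^{b(γ) + m(γ_0+⋯+γ_{i-1})} binom(n'; dec_i γ)_{q^m}
-- sum to q^{b(γ)} binom(n; γ)_{q^m} over all i < m, their first e of them
-- form q^{b(γ)} p^{(e)}_γ(q^m), and rotating γ shifts i by one at the cost
-- of a factor q^n.
module RotationTerms (q m n' : ℕ) where
  Q : ℕ
  Q = q ^ m
  n : ℕ
  n = suc n'
  open QMultinomial Q

  T : List ℕ → ℕ → ℕ
  T γ i = q ^ (bstat γ + m * pre i γ) * binomℤ n' (decAt i γ) Q

  T-factor : ∀ γ i → T γ i ≡ q ^ bstat γ * pascalTerm n' γ i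
  T-factor γ i = begin
    q ^ (bstat γ + m * pre i γ) * B             ≡⟨ cong (_* B) (^-distribˡ-+-* q (bstat γ) (m * pre i γ)) ⟩
    q ^ bstat γ * q ^ (m * pre i γ) * B         ≡⟨ cong (λ t → q ^ bstat γ * t * B) (sym (^-*-assoc q m (pre i γ))) ⟩
    q ^ bstat γ * Q ^ pre i γ * B               ≡⟨ *-assoc (q ^ bstat γ) (Q ^ pre i γ) B ⟩
    q ^ bstat γ * pascalTerm n' γ i             ∎
    where open ≡-Reasoning
          B : ℕ
          B = binomℤ n' (decAt i γ) Q

  T-pascal : ∀ γ → length γ ≡ m → sum γ ≡ n → Σ< m (T γ) ≡ q ^ bstat γ * binomℕ n γ Q
  T-pascal γ refl sm = begin
    Σ< (length γ) (T γ)                                   ≡⟨ Σ-ext (length γ) (T-factor γ) ⟩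
    Σ< (length γ) (λ i → q ^ bstat γ * pascalTerm n' γ i) ≡⟨ sym (Σ-*ˡ (length γ) (q ^ bstat γ) _) ⟩
    q ^ bstat γ * Σ< (length γ) (pascalTerm n' γ)         ≡⟨ cong (q ^ bstat γ *_) (sym (binom-pascal n' γ sm)) ⟩
    q ^ bstat γ * binomℕ n γ Q                            ∎
    where open ≡-Reasoning

  T-pPoly : ∀ e γ → q ^ bstat γ * pPoly n e γ Q ≡ Σ< e (T γ)
  T-pPoly e γ = begin
    q ^ bstat γ * pPoly n e γ Q                          ≡⟨ cong (q ^ bstat γ *_) (sum-upTo e _) ⟩
    q ^ bstat γ * Σ< e (pascalTerm n' γ)                 ≡⟨ Σ-*ˡ e (q ^ bstat γ) _ ⟩
    Σ< e (λ i → q ^ bstat γ * pascalTerm n' γ i)         ≡⟨ Σ-ext e (λ i → sym (T-factor γ i)) ⟩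
    Σ< e (T γ)                                           ∎
    where open ≡-Reasoning

  -- Moving the last part y to the front raises b by |ys| = n - y and the
  -- prefix sums by y, i.e. the exponent of q by n in total.
  T-snoc : ∀ ys y i → suc (length ys) ≡ m → sum (ys ++ y ∷ []) ≡ n → i < length ys →
           T (y ∷ ys) (suc i) ≡ q ^ n * T (ys ++ y ∷ []) i
  T-snoc ys y i lm sm il = begin
    q ^ (bstatFrom 1 ys + m * (y + pre i ys)) * binomℤ n' (ℤ.+ y ∷ decAt i ys) Q
      ≡⟨ cong₂ (λ a b → q ^ a * b) exponent (binomℤ-snoc n' Q (decAt i ys) (ℤ.+ y)) ⟩
    q ^ (n + E) * binomℤ n' (decAt i ys ++ ℤ.+ y ∷ []) Q
      ≡⟨ cong₂ (λ a b → a * binomℤ n' b Q) (^-distribˡ-+-* q n E) (sym (decAt-snoc i ys y il)) ⟩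
    q ^ n * q ^ E * binomℤ n' (decAt i (ys ++ y ∷ [])) Q
      ≡⟨ *-assoc (q ^ n) _ _ ⟩
    q ^ n * T (ys ++ y ∷ []) i ∎
    where
      open ≡-Reasoning
      E : ℕ
      E = bstat (ys ++ y ∷ []) + m * pre i (ys ++ y ∷ [])
      total : sum ys + y ≡ n
      total = trans (cong (sum ys +_) (sym (+-identityʳ y))) (trans (sym (sum-++ ys (y ∷ []))) sm)
      regroup : ∀ s b L y p → s + b + suc L * (y + p) ≡ (s + y) + (b + (0 + L) * y + suc L * p)
      regroup = solve-∀
      exponent : bstatFrom 1 ys + m * (y + pre i ys) ≡ n + E
      exponent = begin
        bstatFrom 1 ys + m * (y + pre i ys)
          ≡⟨ cong₂ (λ a b → a + b * (y + pre i ys)) (bstatFrom-suc 0 ys) (sym lm) ⟩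
        sum ys + bstat ys + suc (length ys) * (y + pre i ys)
          ≡⟨ regroup (sum ys) (bstat ys) (length ys) y (pre i ys) ⟩
        (sum ys + y) + (bstat ys + (0 + length ys) * y + suc (length ys) * pre i ys)
          ≡⟨ cong₂ (λ a b → a + (bstat ys + (0 + length ys) * y + b)) total
                   (cong₂ _*_ lm (sym (pre-snoc i ys y (<⇒≤ il)))) ⟩
        n + (bstat ys + (0 + length ys) * y + m * pre i (ys ++ y ∷ []))
          ≡⟨ cong (λ a → n + (a + m * pre i (ys ++ y ∷ []))) (sym (bstatFrom-snoc 0 ys y)) ⟩
        n + E ∎

  T-rot : ∀ γ i → length γ ≡ m → sum γ ≡ n → suc i < m → T (rot γ) (suc i) ≡ q ^ n * T γ i
  T-rot []       i refl sm ()
  T-rot (x ∷ xs) i lm   sm h =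
    trans (T-snoc ys y i lm' sm' il) (cong (λ l → q ^ n * T l i) (sym (snoc-view x xs)))
    where
      ys : List ℕ
      ys = initOf x xs
      y : ℕ
      y = lastOf x xs
      lm' : suc (length ys) ≡ m
      lm' = trans (length-snoc ys y) (trans (cong length (sym (snoc-view x xs))) lm)
      sm' : sum (ys ++ y ∷ []) ≡ n
      sm' = trans (cong sum (sym (snoc-view x xs))) sm
      il : i < length ys
      il = ≤-pred (subst (suc i <_) (sym lm') h)

pSum : ℕ → ℕ → ℕ → ℕ → List ℕ → ℕ → ℕ
pSum n m d e α q =
  sum (map (λ k → q ^ bstat (rotPow (k * e) α) * pPoly n e (rotPow (k * e) α) (q ^ m)) (upTo d))

-- It is the cyclic summation lemma for U(k, i) = T (σ^k α) i, which is
-- m-periodic in k since σ^m α = α.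
pSum-cleared : ∀ q m n' d e α → length α ≡ m → sum α ≡ suc n' → m ≡ d * e →
  qint d (q ^ (suc n' * e)) * pSum (suc n') m d e α q ≡ sumCd d e α q * binomℕ (suc n') α (q ^ m)
pSum-cleared q m n' d e α lm sm m≡de = begin
  qint d (q ^ (n * e)) * pSum n m d e α q
    ≡⟨ cong₂ _*_ (cong (qint d) (sym (^-*-assoc q n e)))
                 (trans (sum-upTo d _) (Σ-ext d (λ k → T-pPoly e (rotPow (k * e) α)))) ⟩
  qint d ((q ^ n) ^ e) * Σ< d V                                        ≡⟨ cyclic-sum ⟩
  Σ< d (λ k → Σ< m (λ i → U (k * e) i))
    ≡⟨ Σ-ext d (λ k → T-pascal (rotPow (k * e) α) (length-rot (k * e)) (sum-rot (k * e))) ⟩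
  Σ< d (λ k → q ^ bstat (rotPow (k * e) α) * binomℕ n (rotPow (k * e) α) Q)
    ≡⟨ Σ-ext d (λ k → cong (q ^ bstat (rotPow (k * e) α) *_) (binomℕ-rotPow n Q (k * e) α)) ⟩
  Σ< d (λ k → q ^ bstat (rotPow (k * e) α) * binomℕ n α Q)
    ≡⟨ sym (Σ-*ʳ d (binomℕ n α Q) (λ k → q ^ bstat (rotPow (k * e) α))) ⟩
  Σ< d (λ k → q ^ bstat (rotPow (k * e) α)) * binomℕ n α Q            ≡⟨ cong (_* binomℕ n α Q) (sym (sum-upTo d _)) ⟩
  sumCd d e α q * binomℕ n α Q                                         ∎
  where
    open ≡-Reasoning
    open RotationTerms q m n'

    length-rot : ∀ k → length (rotPow k α) ≡ m
    length-rot k = trans (rotPow-invariant length length-snoc k α) lm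

    sum-rot : ∀ k → sum (rotPow k α) ≡ n
    sum-rot k = trans (rotPow-invariant sum sum-snoc k α) sm

    U : ℕ → ℕ → ℕ
    U k i = T (rotPow k α) i

    U-periodic : ∀ k i → U (k + m) i ≡ U k i
    U-periodic k i = cong (λ l → T l i) (begin
      rotPow (k + m) α          ≡⟨ rotPow-+ k m α ⟩
      rotPow k (rotPow m α)     ≡⟨ cong (λ t → rotPow k (rotPow t α)) (sym lm) ⟩
      rotPow k (rotPow (length α) α) ≡⟨ cong (rotPow k) (rotPow-length α) ⟩
      rotPow k α                ∎)

    U-shift : ∀ k i → suc i < m → U (suc k) (suc i) ≡ q ^ n * U k i
    U-shift k i = T-rot (rotPow k α) i (length-rot k) (sum-rot k)

    open CyclicSum U m d e (q ^ n) m≡de U-periodic U-shift using (V; cyclic-sum)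

<ᵇ-true : ∀ i j → i < j → (i <ᵇ j) ≡ true
<ᵇ-true zero    (suc j) _       = refl
<ᵇ-true (suc i) (suc j) (s≤s h) = <ᵇ-true i j h

<ᵇ-false : ∀ i j → j ≤ i → (i <ᵇ j) ≡ false
<ᵇ-false i       zero    _       = refl
<ᵇ-false (suc i) (suc j) (s≤s h) = <ᵇ-false i j h

≡ᵇ-refl : ∀ i → (i ≡ᵇ i) ≡ true
≡ᵇ-refl zero    = refl
≡ᵇ-refl (suc i) = ≡ᵇ-refl i

≡ᵇ-false : ∀ i j → i ≢ j → (i ≡ᵇ j) ≡ false
≡ᵇ-false zero    zero    ne = ⊥-elim (ne refl)
≡ᵇ-false zero    (suc j) ne = refl
≡ᵇ-false (suc i) zero    ne = refl
≡ᵇ-false (suc i) (suc j) ne = ≡ᵇ-false i j (λ e → ne (cong suc e))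

≡ᵇ-pred : ∀ k x → 1 ≤ x → (suc k ≡ᵇ x) ≡ (k ≡ᵇ x ∸ 1)
≡ᵇ-pred k (suc x) _ = refl

and-snoc-∧ : (xs : List Bool) (b : Bool) → and (xs ++ b ∷ []) ≡ and xs ∧ b
and-snoc-∧ []           b = ∧-identityʳ b
and-snoc-∧ (true  ∷ xs) b = and-snoc-∧ xs b
and-snoc-∧ (false ∷ xs) b = refl

and-upTo-suc : ∀ m (f : ℕ → Bool) → and (map f (upTo (suc m))) ≡ and (map f (upTo m)) ∧ f m
and-upTo-suc m f = begin
  and (map f (upTo (suc m)))        ≡⟨ cong (λ l → and (map f l)) (sym (upTo-∷ʳ m)) ⟩
  and (map f (upTo m ++ m ∷ []))    ≡⟨ cong and (map-++ f (upTo m) (m ∷ [])) ⟩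
  and (map f (upTo m) ++ f m ∷ [])  ≡⟨ and-snoc-∧ (map f (upTo m)) (f m) ⟩
  and (map f (upTo m)) ∧ f m        ∎
  where open ≡-Reasoning

and-upTo-cong : ∀ m (f g : ℕ → Bool) → (∀ i → i < m → f i ≡ g i) → and (map f (upTo m)) ≡ and (map g (upTo m))
and-upTo-cong zero    f g h = refl
and-upTo-cong (suc m) f g h = begin
  and (map f (upTo (suc m)))  ≡⟨ and-upTo-suc m f ⟩
  and (map f (upTo m)) ∧ f m  ≡⟨ cong₂ _∧_ (and-upTo-cong m f g (λ i i<m → h i (m<n⇒m<1+n i<m))) (h m ≤-refl) ⟩
  and (map g (upTo m)) ∧ g m  ≡⟨ sym (and-upTo-suc m g) ⟩
  and (map g (upTo (suc m)))  ∎
  where open ≡-Reasoning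

and-upTo-false : ∀ m (f : ℕ → Bool) j → j < m → f j ≡ false → and (map f (upTo m)) ≡ false
and-upTo-false (suc m) f j j<m fj with m≤n⇒m<n∨m≡n (≤-pred j<m)
... | inj₁ j<m' rewrite and-upTo-suc m f | and-upTo-false m f j j<m' fj = refl
... | inj₂ refl rewrite and-upTo-suc m f | fj = ∧-zeroʳ _

and-true : {A : Set} (f : A → Bool) → (∀ x → f x ≡ true) → ∀ xs → and (map f xs) ≡ true
and-true f h []       = refl
and-true f h (x ∷ xs) rewrite h x = and-true f h xs

ind : Bool → ℕ → ℕ
ind b x = if b then x else 0

ind-* : ∀ b x y → ind b x * y ≡ ind b (x * y)
ind-* true  x y = refl
ind-* false x y = refl

sum-filter : {A : Set} (p : A → Bool) (f : A → ℕ) (xs : List A) →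
             sum (map f (filterᵇ p xs)) ≡ sum (map (λ w → ind (p w) (f w)) xs)
sum-filter p f []       = refl
sum-filter p f (x ∷ xs) with p x
... | true  = cong (f x +_) (sum-filter p f xs)
... | false = sum-filter p f xs

sum-ext : {A : Set} (f g : A → ℕ) → (∀ x → f x ≡ g x) → ∀ xs → sum (map f xs) ≡ sum (map g xs)
sum-ext f g h []       = refl
sum-ext f g h (x ∷ xs) = cong₂ _+_ (h x) (sum-ext f g h xs)

sum-concatMap : {A B : Set} (f : B → ℕ) (g : A → List B) (xs : List A) →
  sum (map f (concatMap g xs)) ≡ sum (map (λ x → sum (map f (g x))) xs)
sum-concatMap f g []       = refl
sum-concatMap f g (x ∷ xs) = begin
  sum (map f (g x ++ concatMap g xs))              ≡⟨ cong sum (map-++ f (g x) (concatMap g xs)) ⟩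
  sum (map f (g x) ++ map f (concatMap g xs))      ≡⟨ sum-++ (map f (g x)) _ ⟩
  sum (map f (g x)) + sum (map f (concatMap g xs)) ≡⟨ cong (sum (map f (g x)) +_) (sum-concatMap f g xs) ⟩
  sum (map f (g x)) + sum (map (λ x → sum (map f (g x))) xs) ∎
  where open ≡-Reasoning

words-snoc : ∀ N (cs : List Cell) (f : List Cell → ℕ) →
  sum (map f (words (suc N) cs)) ≡ sum (map (λ w → sum (map (λ c → f (w ∷ʳ c)) cs)) (words N cs))
words-snoc zero cs f = begin
  sum (map f (concatMap (λ c → map (c ∷_) ([] ∷ [])) cs)) ≡⟨ sum-concatMap f _ cs ⟩
  sum (map (λ c → f (c ∷ []) + 0) cs)                     ≡⟨ sum-ext _ _ (λ c → +-identityʳ _) cs ⟩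
  sum (map (λ c → f (c ∷ [])) cs)                         ≡⟨ sym (+-identityʳ _) ⟩
  sum (map (λ c → f (c ∷ [])) cs) + 0                     ∎
  where open ≡-Reasoning
words-snoc (suc N) cs f = begin
  sum (map f (concatMap (λ c → map (c ∷_) (words (suc N) cs)) cs)) ≡⟨ sum-concatMap f _ cs ⟩
  sum (map (λ c → sum (map f (map (c ∷_) (words (suc N) cs)))) cs)
    ≡⟨ sum-ext _ _ (λ c → trans (cong sum (sym (map-∘ (words (suc N) cs))))
                                (words-snoc N cs (λ w → f (c ∷ w)))) cs ⟩
  sum (map (λ c → sum (map (λ w → h (c ∷ w)) (words N cs))) cs)
    ≡⟨ sum-ext _ _ (λ c → cong sum (map-∘ (words N cs))) cs ⟩
  sum (map (λ c → sum (map h (map (c ∷_) (words N cs)))) cs) ≡⟨ sym (sum-concatMap h _ cs) ⟩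
  sum (map h (words (suc N) cs))                               ∎
  where open ≡-Reasoning
        h : List Cell → ℕ
        h w = sum (map (λ c → f (w ∷ʳ c)) cs)

maj-snoc : ∀ k (xs : List Cell) a b →
  majFrom k (xs ++ a ∷ b ∷ []) ≡ majFrom k (xs ++ a ∷ []) + (if lowerRow b a then k + length xs else 0)
maj-snoc k [] a b with lowerRow b a
... | true  = refl
... | false = refl
maj-snoc k (x ∷ []) a b with lowerRow b a
... | true  = last-descent (if lowerRow a x then k else 0) k
  where last-descent : ∀ L k → L + (suc k + 0) ≡ L + 0 + (k + 1)
        last-descent = solve-∀
... | false = sym (+-identityʳ _)
maj-snoc k (x ∷ y ∷ xs) a b = begin
  L + majFrom (suc k) (y ∷ xs ++ a ∷ b ∷ [])   ≡⟨ cong (L +_) (maj-snoc (suc k) (y ∷ xs) a b) ⟩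
  L + (majFrom (suc k) (y ∷ xs ++ a ∷ []) + D (suc k + length (y ∷ xs)))  ≡⟨ sym (+-assoc L _ _) ⟩
  L + majFrom (suc k) (y ∷ xs ++ a ∷ []) + D (suc k + length (y ∷ xs))
    ≡⟨ cong (λ t → L + majFrom (suc k) (y ∷ xs ++ a ∷ []) + D t) (sym (+-suc k (length (y ∷ xs)))) ⟩
  L + majFrom (suc k) (y ∷ xs ++ a ∷ []) + D (k + length (x ∷ y ∷ xs)) ∎
  where open ≡-Reasoning
        L : ℕ
        L = if lowerRow y x then k else 0
        D : ℕ → ℕ
        D t = if lowerRow b a then t else 0

-- For a sequence of one-row
-- partitions these are exactly the row cells, a standard tableau is any word
-- with the right content, and "strictly lower row" means a larger letter.
letters : ℕ → List Cell
letters m = map (λ i → (i , 0)) (upTo m)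

rowsFrom-oneRow : ∀ j α → rowsFrom j (oneRow α) ≡ map (λ i → (j + i , 0)) (upTo (length α))
rowsFrom-oneRow j []      = refl
rowsFrom-oneRow j (a ∷ α) = begin
  (j , 0) ∷ rowsFrom (suc j) (oneRow α)
    ≡⟨ cong₂ _∷_ (cong (_, 0) (sym (+-identityʳ j))) (rowsFrom-oneRow (suc j) α) ⟩
  (j + 0 , 0) ∷ map (λ i → (suc j + i , 0)) (upTo (length α))
    ≡⟨ cong ((j + 0 , 0) ∷_) (map-cong (λ i → cong (_, 0) (sym (+-suc j i))) (upTo (length α))) ⟩
  (j + 0 , 0) ∷ map (λ i → (j + suc i , 0)) (upTo (length α))
    ≡⟨ cong ((j + 0 , 0) ∷_) (trans (map-∘ {g = λ i → (j + i , 0)} {f = suc} (upTo (length α))) (cong (map _) (map-upTo suc (length α)))) ⟩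
  map (λ i → (j + i , 0)) (upTo (suc (length α))) ∎
  where open ≡-Reasoning

rowsOf-oneRow : ∀ α → rowsOf (oneRow α) ≡ letters (length α)
rowsOf-oneRow α = rowsFrom-oneRow 0 α

rowLen-oneRow : ∀ α i → rowLen (oneRow α) (i , 0) ≡ nth i α
rowLen-oneRow []      i       = refl
rowLen-oneRow (a ∷ α) zero    = refl
rowLen-oneRow (a ∷ α) (suc i) = rowLen-oneRow α i

totalSize-oneRow : ∀ α → totalSize (oneRow α) ≡ sum α
totalSize-oneRow []      = refl
totalSize-oneRow (a ∷ α) = cong₂ _+_ (+-identityʳ a) (totalSize-oneRow α)

module Words (m : ℕ) where

  letter : ℕ → Cell
  letter i = (i , 0)

  sumWords : ℕ → (List Cell → ℕ) → ℕ
  sumWords zero    f = f []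
  sumWords (suc N) f = sumWords N (λ w → Σ< m (λ i → f (w ∷ʳ letter i)))

  sumWords-lcong : ∀ N (f g : List Cell → ℕ) → (∀ w → length w ≡ N → f w ≡ g w) → sumWords N f ≡ sumWords N g
  sumWords-lcong zero    f g h = h [] refl
  sumWords-lcong (suc N) f g h = sumWords-lcong N _ _ (λ w lw → Σ-ext m (λ i → h (w ∷ʳ letter i) (length-snoc' w lw)))
    where length-snoc' : ∀ w {i} → length w ≡ N → length (w ∷ʳ letter i) ≡ suc N
          length-snoc' w lw = trans (length-++ w) (trans (+-comm (length w) 1) (cong suc lw))

  sumWords-ext : ∀ N (f g : List Cell → ℕ) → (∀ w → f w ≡ g w) → sumWords N f ≡ sumWords N g
  sumWords-ext N f g h = sumWords-lcong N f g (λ w _ → h w)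

  words-sumWords : ∀ N (f : List Cell → ℕ) → sum (map f (words N (letters m))) ≡ sumWords N f
  words-sumWords zero    f = +-identityʳ (f [])
  words-sumWords (suc N) f = begin
    sum (map f (words (suc N) (letters m)))
      ≡⟨ words-snoc N (letters m) f ⟩
    sum (map (λ w → sum (map (λ c → f (w ∷ʳ c)) (letters m))) (words N (letters m)))
      ≡⟨ words-sumWords N _ ⟩
    sumWords N (λ w → sum (map (λ c → f (w ∷ʳ c)) (letters m)))
      ≡⟨ sumWords-ext N _ _ (λ w → trans (cong sum (sym (map-∘ (upTo m)))) (sum-upTo m _)) ⟩
    sumWords (suc N) f ∎
    where open ≡-Reasoning

  sumWords-zero : ∀ N → sumWords N (λ _ → 0) ≡ 0
  sumWords-zero zero    = refl
  sumWords-zero (suc N) = trans (sumWords-ext N _ _ (λ w → Σ-zero m)) (sumWords-zero N)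

  sumWords-Σ : ∀ N k (g : List Cell → ℕ → ℕ) → sumWords N (λ w → Σ< k (g w)) ≡ Σ< k (λ i → sumWords N (λ w → g w i))
  sumWords-Σ zero    k g = refl
  sumWords-Σ (suc N) k g = trans (sumWords-ext N _ _ (λ w → Σ-swap m k (λ i j → g (w ∷ʳ letter i) j)))
                                 (sumWords-Σ N k (λ w j → Σ< m (λ i → g (w ∷ʳ letter i) j)))

  sumWords-*ʳ : ∀ N (f : List Cell → ℕ) y → sumWords N f * y ≡ sumWords N (λ w → f w * y)
  sumWords-*ʳ zero    f y = refl
  sumWords-*ʳ (suc N) f y = trans (sumWords-*ʳ N _ y) (sumWords-ext N _ _ (λ w → Σ-*ʳ m y _))

  hasContent : List ℕ → List Cell → Bool
  hasContent β w = and (map (λ i → count (letter i) w ≡ᵇ nth i β) (upTo m))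

  count-++ : ∀ x (xs ys : List Cell) → count x (xs ++ ys) ≡ count x xs + count x ys
  count-++ x []       ys = refl
  count-++ x (y ∷ xs) ys = trans (cong ((if eqCell x y then 1 else 0) +_) (count-++ x xs ys))
                                 (sym (+-assoc (if eqCell x y then 1 else 0) (count x xs) (count x ys)))

  count-snoc-≡ : ∀ i w → count (letter i) (w ∷ʳ letter i) ≡ suc (count (letter i) w)
  count-snoc-≡ i w rewrite count-++ (letter i) w (letter i ∷ []) | ≡ᵇ-refl i = +-comm _ 1

  count-snoc-≢ : ∀ i j w → i ≢ j → count (letter i) (w ∷ʳ letter j) ≡ count (letter i) w
  count-snoc-≢ i j w ne rewrite count-++ (letter i) w (letter j ∷ []) | ≡ᵇ-false i j ne = +-identityʳ _

  hasContent-snoc : ∀ β j w → 1 ≤ nth j β → hasContent β (w ∷ʳ letter j) ≡ hasContent (decℕ j β) w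
  hasContent-snoc β j w h = and-upTo-cong m _ _ entry
    where
      entry : ∀ i → i < m → (count (letter i) (w ∷ʳ letter j) ≡ᵇ nth i β) ≡ (count (letter i) w ≡ᵇ nth i (decℕ j β))
      entry i _ with i ≟ j
      ... | yes refl rewrite count-snoc-≡ i w | nth-dec-≡ i β = ≡ᵇ-pred (count (letter i) w) (nth i β) h
      ... | no i≢j   rewrite count-snoc-≢ i j w i≢j | nth-dec-≢ i j β i≢j = refl

  hasContent-snoc-zero : ∀ β j w → j < m → nth j β ≡ 0 → hasContent β (w ∷ʳ letter j) ≡ false
  hasContent-snoc-zero β j w j<m βⱼ≡0 = and-upTo-false m _ j j<m mismatch
    where mismatch : (count (letter j) (w ∷ʳ letter j) ≡ᵇ nth j β) ≡ false
          mismatch rewrite count-snoc-≡ j w | βⱼ≡0 = refl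

  hasContent-nil : ∀ β → sum β ≡ 0 → hasContent β [] ≡ true
  hasContent-nil β s = trans (and-upTo-cong m _ (λ _ → true) (λ i _ → cong (0 ≡ᵇ_) (entry-zero i β s)))
                             (and-true (λ _ → true) (λ _ → refl) (upTo m))
    where entry-zero : ∀ i β → sum β ≡ 0 → nth i β ≡ 0
          entry-zero i       []       _ = refl
          entry-zero zero    (zero ∷ β) _ = refl
          entry-zero (suc i) (zero ∷ β) s = entry-zero i β s

  lowerRow-letter : ∀ i j → lowerRow (letter j) (letter i) ≡ (i <ᵇ j)
  lowerRow-letter i j = trans (cong ((i <ᵇ j) ∨_) (∧-zeroʳ (i ≡ᵇ j))) (∨-identityʳ (i <ᵇ j))

-- MacMahon's theorem: summing Q^maj over the words of length N with
-- content β gives binom(N; β)_Q.  Splitting off the last letter j, the words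
-- ending in j contribute exactly the Pascal term Q^{pre j β} binom(N-1; dec_j β)_Q;
-- this is proved by induction on N, splitting off the second-to-last letter i,
-- which creates a descent at position N exactly when i < j.
module MajorIndex (Q m : ℕ) where
  open Words m
  open QMultinomial Q

  -- Exponent of Q contributed by appending j to a word of length N+1 ending
  -- in i: the descent position N+1 when i < j.
  descentExp : ℕ → ℕ → ℕ → ℕ
  descentExp N j i = if i <ᵇ j then suc N else 0

  -- Σ_i Q^{pre i γ} [γ_i]_Q Q^{[i<j](N+1)} = Q^{pre j γ} [N+1]_Q: the parts
  -- before j give [p]_Q Q^{N+1}, those from j on give Q^p [N+1-p]_Q.
  descent-qint : ∀ N γ j → length γ ≡ m → sum γ ≡ suc N → j ≤ m →
    Σ< m (λ i → Q ^ pre i γ * qint (nth i γ) Q * Q ^ descentExp N j i) ≡ Q ^ pre j γ * qint (suc N) Q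
  descent-qint N γ j refl sm j≤m = begin
    Σ< m (λ i → a i * Q ^ descentExp N j i)           ≡⟨ cong (λ t → Σ< t (λ i → a i * Q ^ descentExp N j i)) m≡j+ ⟩
    Σ< (j + (m ∸ j)) (λ i → a i * Q ^ descentExp N j i) ≡⟨ Σ-split j (m ∸ j) _ ⟩
    Σ< j (λ i → a i * Q ^ descentExp N j i) + Σ< (m ∸ j) (λ t → a (j + t) * Q ^ descentExp N j (j + t))
      ≡⟨ cong₂ _+_ (Σ-cong j (λ i i<j → cong (λ b → a i * Q ^ (if b then suc N else 0)) (<ᵇ-true i j i<j)))
                   (Σ-ext (m ∸ j) (λ t → trans (cong (λ b → a (j + t) * Q ^ (if b then suc N else 0))
                                                     (<ᵇ-false (j + t) j (m≤m+n j t)))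
                                               (*-identityʳ _))) ⟩
    Σ< j (λ i → a i * Q ^ suc N) + tail               ≡⟨ cong₂ _+_ (sym (Σ-*ʳ j (Q ^ suc N) a)) tail-qint ⟩
    Σ< j a * Q ^ suc N + Q ^ p * qint r Q             ≡⟨ cong (λ t → t * Q ^ suc N + Q ^ p * qint r Q) (Σ-qint j γ Q) ⟩
    qint p Q * Q ^ suc N + Q ^ p * qint r Q           ≡⟨ cong (λ t → qint p Q * Q ^ t + Q ^ p * qint r Q) N+1≡p+r ⟩
    qint p Q * Q ^ (p + r) + Q ^ p * qint r Q         ≡⟨ cong (λ t → qint p Q * t + Q ^ p * qint r Q) (^-distribˡ-+-* Q p r) ⟩
    qint p Q * (Q ^ p * Q ^ r) + Q ^ p * qint r Q     ≡⟨ regroup (qint p Q) (Q ^ p) (Q ^ r) (qint r Q) ⟩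
    Q ^ p * (qint r Q + Q ^ r * qint p Q)             ≡⟨ cong (Q ^ p *_) (sym (qint-+ r p Q)) ⟩
    Q ^ p * qint (r + p) Q                            ≡⟨ cong (λ t → Q ^ p * qint t Q) (trans (+-comm r p) (sym N+1≡p+r)) ⟩
    Q ^ p * qint (suc N) Q                            ∎
    where
      open ≡-Reasoning
      p : ℕ
      p = pre j γ
      r : ℕ
      r = suc N ∸ p
      a : ℕ → ℕ
      a i = Q ^ pre i γ * qint (nth i γ) Q
      tail : ℕ
      tail = Σ< (m ∸ j) (λ t → a (j + t))
      m≡j+ : m ≡ j + (m ∸ j)
      m≡j+ = sym (m+[n∸m]≡n j≤m)
      N+1≡p+r : suc N ≡ p + r
      N+1≡p+r = sym (m+[n∸m]≡n (subst (p ≤_) sm (pre-≤ j γ)))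
      regroup : ∀ x y z w → x * (y * z) + y * w ≡ y * (w + z * x)
      regroup = solve-∀
      -- [N+1] = Σ_{i<m} a i = [p] + tail and [N+1] = [p] + Q^p [r]
      tail-qint : tail ≡ Q ^ p * qint r Q
      tail-qint = +-cancelˡ-≡ (qint p Q) tail _ (begin
        qint p Q + tail                 ≡⟨ cong (_+ tail) (sym (Σ-qint j γ Q)) ⟩
        Σ< j a + tail                   ≡⟨ sym (Σ-split j (m ∸ j) a) ⟩
        Σ< (j + (m ∸ j)) a              ≡⟨ cong (λ t → Σ< t a) (sym m≡j+) ⟩
        Σ< m a                          ≡⟨ Σ-qint-all γ Q ⟩
        qint (sum γ) Q                  ≡⟨ cong (λ t → qint t Q) (trans sm N+1≡p+r) ⟩
        qint (p + r) Q                  ≡⟨ qint-+ p r Q ⟩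
        qint p Q + Q ^ p * qint r Q     ∎)

  shifted-pascal : ∀ N γ j → length γ ≡ m → sum γ ≡ suc N → j ≤ m →
    Σ< m (λ i → pascalTerm N γ i * Q ^ descentExp N j i) ≡ Q ^ pre j γ * binomℕ (suc N) γ Q
  shifted-pascal N γ j lm sm j≤m = *-cancelʳ-pos P _ _ (prodFact-pos γ Q) (begin
    Σ< m (λ i → pascalTerm N γ i * Q ^ E i) * P         ≡⟨ Σ-*ʳ m P _ ⟩
    Σ< m (λ i → pascalTerm N γ i * Q ^ E i * P)
      ≡⟨ Σ-cong m (λ i i<m → trans (swap₂₃ (pascalTerm N γ i) (Q ^ E i) P)
                                   (cong (_* Q ^ E i) (pascalTerm-cleared N γ i sm (subst (i <_) (sym lm) i<m)))) ⟩
    Σ< m (λ i → a i * qfact N Q * Q ^ E i)              ≡⟨ Σ-ext m (λ i → swap₁₂ (a i) (qfact N Q) (Q ^ E i)) ⟩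
    Σ< m (λ i → qfact N Q * (a i * Q ^ E i))            ≡⟨ sym (Σ-*ˡ m (qfact N Q) _) ⟩
    qfact N Q * Σ< m (λ i → a i * Q ^ E i)              ≡⟨ cong (qfact N Q *_) (descent-qint N γ j lm sm j≤m) ⟩
    qfact N Q * (Q ^ p * qint (suc N) Q)                ≡⟨ rotate (qfact N Q) (Q ^ p) (qint (suc N) Q) ⟩
    Q ^ p * qfact (suc N) Q                             ≡⟨ cong (Q ^ p *_) (sym (binom-integral (suc N) γ sm)) ⟩
    Q ^ p * (binomℕ (suc N) γ Q * P)                    ≡⟨ sym (*-assoc (Q ^ p) _ P) ⟩
    Q ^ p * binomℕ (suc N) γ Q * P                      ∎)
    where
      open ≡-Reasoning
      P : ℕ
      P = prodFact γ Q
      p : ℕ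
      p = pre j γ
      E : ℕ → ℕ
      E = descentExp N j
      a : ℕ → ℕ
      a i = Q ^ pre i γ * qint (nth i γ) Q
      swap₂₃ : ∀ x y z → x * y * z ≡ x * z * y
      swap₂₃ = solve-∀
      swap₁₂ : ∀ x y z → x * y * z ≡ y * (x * z)
      swap₁₂ = solve-∀
      rotate : ∀ x y z → x * (y * z) ≡ y * (z * x)
      rotate = solve-∀

  endingAt : ℕ → List ℕ → ℕ → ℕ
  endingAt N β j = sumWords N (λ w → ind (hasContent β (w ∷ʳ letter j)) (Q ^ maj (w ∷ʳ letter j)))

  append-letter : ∀ N β j i w → 1 ≤ nth j β → length w ≡ N →
    ind (hasContent β ((w ∷ʳ letter i) ∷ʳ letter j)) (Q ^ maj ((w ∷ʳ letter i) ∷ʳ letter j))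
      ≡ ind (hasContent (decℕ j β) (w ∷ʳ letter i)) (Q ^ maj (w ∷ʳ letter i)) * Q ^ descentExp N j i
  append-letter N β j i w βⱼ≥1 refl = begin
    ind (hasContent β (wi ∷ʳ letter j)) (Q ^ maj (wi ∷ʳ letter j))
      ≡⟨ cong₂ ind (hasContent-snoc β j wi βⱼ≥1) (cong (Q ^_) maj-append) ⟩
    ind ok (Q ^ (maj wi + descentExp N j i))   ≡⟨ cong (ind ok) (^-distribˡ-+-* Q (maj wi) (descentExp N j i)) ⟩
    ind ok (Q ^ maj wi * Q ^ descentExp N j i) ≡⟨ sym (ind-* ok (Q ^ maj wi) (Q ^ descentExp N j i)) ⟩
    ind ok (Q ^ maj wi) * Q ^ descentExp N j i ∎
    where
      open ≡-Reasoning
      wi : List Cell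
      wi = w ∷ʳ letter i
      ok : Bool
      ok = hasContent (decℕ j β) wi
      maj-append : maj (wi ∷ʳ letter j) ≡ maj wi + descentExp N j i
      maj-append = begin
        majFrom 1 ((w ++ letter i ∷ []) ++ letter j ∷ []) ≡⟨ cong (majFrom 1) (++-assoc w (letter i ∷ []) (letter j ∷ [])) ⟩
        majFrom 1 (w ++ letter i ∷ letter j ∷ [])        ≡⟨ maj-snoc 1 w (letter i) (letter j) ⟩
        maj wi + (if lowerRow (letter j) (letter i) then 1 + length w else 0)
          ≡⟨ cong (λ b → maj wi + (if b then 1 + length w else 0)) (lowerRow-letter i j) ⟩
        maj wi + descentExp N j i ∎

  endingAt-pascalTerm : ∀ N β j → length β ≡ m → sum β ≡ suc N → j < m → endingAt N β j ≡ pascalTerm N β j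
  endingAt-pascalTerm N β j lm sm j<m with nth j β in βⱼ
  endingAt-pascalTerm N β j lm sm j<m | zero = begin
    endingAt N β j    ≡⟨ sumWords-ext N _ _ (λ w → cong (λ b → ind b (Q ^ maj (w ∷ʳ letter j)))
                                                        (hasContent-snoc-zero β j w j<m βⱼ)) ⟩
    sumWords N (λ _ → 0)  ≡⟨ sumWords-zero N ⟩
    0                     ≡⟨ sym (*-zeroʳ (Q ^ pre j β)) ⟩
    Q ^ pre j β * 0       ≡⟨ cong (Q ^ pre j β *_) (sym (binomℤ-zero N j β Q (subst (j <_) (sym lm) j<m) βⱼ)) ⟩
    pascalTerm N β j      ∎
    where open ≡-Reasoning
  endingAt-pascalTerm zero β j lm sm j<m | suc x = begin
    ind (hasContent β (letter j ∷ [])) 1 ≡⟨ cong (λ b → ind b 1) (trans (hasContent-snoc β j [] βⱼ≥1) (hasContent-nil γ sum-γ)) ⟩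
    1                                    ≡⟨ sym (cong₂ _*_ (cong (Q ^_) pre-j≡0) binom-empty) ⟩
    Q ^ pre j β * binomℕ 0 γ Q           ≡⟨ cong (Q ^ pre j β *_) (sym (binomℤ-pos 0 j β Q βⱼ≥1)) ⟩
    pascalTerm zero β j                  ∎
    where
      open ≡-Reasoning
      βⱼ≥1 : 1 ≤ nth j β
      βⱼ≥1 = subst (1 ≤_) (sym βⱼ) (s≤s z≤n)
      γ : List ℕ
      γ = decℕ j β
      sum-γ : sum γ ≡ 0
      sum-γ = suc-injective (trans (sum-dec j β βⱼ≥1) sm)
      binom-empty : binomℕ 0 γ Q ≡ 1
      binom-empty = trans (sym (*-identityʳ _)) (trans (cong (binomℕ 0 γ Q *_) (sym (prodFact-zero γ Q sum-γ)))
                                                        (binom-integral 0 γ sum-γ))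
      -- the single letter j uses up all of |β| = 1, so no part precedes it
      pre-j≡0 : pre j β ≡ 0
      pre-j≡0 = n≤0⇒n≡0 (m+n≤o⇒m≤o (pre j β) (≤-pred (subst (_≤ 1) (+-suc (pre j β) x)
                  (subst₂ _≤_ (trans (pre-suc j β) (cong (pre j β +_) βⱼ)) sm (pre-≤ (suc j) β)))))
  endingAt-pascalTerm (suc N) β j lm sm j<m | suc x = begin
    endingAt (suc N) β j
      ≡⟨ sumWords-lcong N _ _ (λ w lw → Σ-ext m (λ i → append-letter N β j i w βⱼ≥1 lw)) ⟩
    sumWords N (λ w → Σ< m (λ i → ind (hasContent γ (w ∷ʳ letter i)) (Q ^ maj (w ∷ʳ letter i)) * Q ^ descentExp N j i))
      ≡⟨ sumWords-Σ N m _ ⟩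
    Σ< m (λ i → sumWords N (λ w → ind (hasContent γ (w ∷ʳ letter i)) (Q ^ maj (w ∷ʳ letter i)) * Q ^ descentExp N j i))
      ≡⟨ Σ-ext m (λ i → sym (sumWords-*ʳ N _ (Q ^ descentExp N j i))) ⟩
    Σ< m (λ i → endingAt N γ i * Q ^ descentExp N j i)
      ≡⟨ Σ-cong m (λ i i<m → cong (_* Q ^ descentExp N j i) (endingAt-pascalTerm N γ i length-γ sum-γ i<m)) ⟩
    Σ< m (λ i → pascalTerm N γ i * Q ^ descentExp N j i) ≡⟨ shifted-pascal N γ j length-γ sum-γ (<⇒≤ j<m) ⟩
    Q ^ pre j γ * binomℕ (suc N) γ Q
      ≡⟨ cong₂ _*_ (cong (Q ^_) (pre-dec j j β ≤-refl)) (sym (binomℤ-pos (suc N) j β Q βⱼ≥1)) ⟩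
    pascalTerm (suc N) β j ∎
    where
      open ≡-Reasoning
      βⱼ≥1 : 1 ≤ nth j β
      βⱼ≥1 = subst (1 ≤_) (sym βⱼ) (s≤s z≤n)
      γ : List ℕ
      γ = decℕ j β
      length-γ : length γ ≡ m
      length-γ = trans (length-dec j β) lm
      sum-γ : sum γ ≡ suc N
      sum-γ = suc-injective (trans (sum-dec j β βⱼ≥1) sm)

  maj-generating : ∀ N β → length β ≡ m → sum β ≡ suc N →
    sumWords (suc N) (λ w → ind (hasContent β w) (Q ^ maj w)) ≡ binomℕ (suc N) β Q
  maj-generating N β lm sm = begin
    sumWords (suc N) (λ w → ind (hasContent β w) (Q ^ maj w)) ≡⟨ sumWords-Σ N m _ ⟩
    Σ< m (endingAt N β)        ≡⟨ Σ-cong m (λ j j<m → endingAt-pascalTerm N β j lm sm j<m) ⟩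
    Σ< m (pascalTerm N β)      ≡⟨ cong (λ t → Σ< t (pascalTerm N β)) (sym lm) ⟩
    Σ< (length β) (pascalTerm N β) ≡⟨ sym (binom-pascal N β sm) ⟩
    binomℕ (suc N) β Q         ∎
    where open ≡-Reasoning

-- For one-row partitions the standard tableaux are the words with content
-- α, so SYT(α)^maj(Q) = binom(n; α)_Q.
isSYT-oneRow : ∀ α w → isSYT (oneRow α) w ≡ Words.hasContent (length α) α w
isSYT-oneRow α w = cong₂ _∧_ (and-true (latticeOK (oneRow α)) lattice-trivial (inits w)) row-lengths
  where
    open Words (length α)
    on-rows : (g : Cell → Bool) → and (map g (rowsOf (oneRow α))) ≡ and (map (λ i → g (i , 0)) (upTo (length α)))
    on-rows g = trans (cong (λ l → and (map g l)) (rowsOf-oneRow α)) (cong and (sym (map-∘ (upTo (length α)))))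
    lattice-trivial : ∀ p → latticeOK (oneRow α) p ≡ true
    lattice-trivial p = trans (on-rows _) (and-true _ (λ i → refl) (upTo (length α)))
    row-lengths : and (map (λ c → count c w ≡ᵇ rowLen (oneRow α) c) (rowsOf (oneRow α))) ≡ hasContent α w
    row-lengths = trans (on-rows _) (and-upTo-cong (length α) _ _ (λ i _ → cong (count (i , 0) w ≡ᵇ_) (rowLen-oneRow α i)))

sytMaj-oneRow : ∀ Q α n' → sum α ≡ suc n' → sytMaj (oneRow α) Q ≡ binomℕ (suc n') α Q
sytMaj-oneRow Q α n' sm = begin
  sytMaj (oneRow α) Q
    ≡⟨ sum-filter (isSYT (oneRow α)) (λ w → Q ^ maj w) (words (totalSize (oneRow α)) (rowsOf (oneRow α))) ⟩
  sum (map (λ w → ind (isSYT (oneRow α) w) (Q ^ maj w)) (words (totalSize (oneRow α)) (rowsOf (oneRow α))))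
    ≡⟨ cong₂ (λ N cs → sum (map (λ w → ind (isSYT (oneRow α) w) (Q ^ maj w)) (words N cs)))
             (trans (totalSize-oneRow α) sm) (rowsOf-oneRow α) ⟩
  sum (map (λ w → ind (isSYT (oneRow α) w) (Q ^ maj w)) (words (suc n') (letters (length α))))
    ≡⟨ words-sumWords (suc n') _ ⟩
  sumWords (suc n') (λ w → ind (isSYT (oneRow α) w) (Q ^ maj w))
    ≡⟨ sumWords-ext (suc n') _ _ (λ w → cong (λ b → ind b (Q ^ maj w)) (isSYT-oneRow α w)) ⟩
  sumWords (suc n') (λ w → ind (hasContent α w) (Q ^ maj w))
    ≡⟨ maj-generating n' α refl sm ⟩
  binomℕ (suc n') α Q ∎
  where open ≡-Reasoning
        open Words (length α)
        open MajorIndex Q (length α)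

least-below : (P : ℕ → Set) → (∀ n → Dec (P n)) → ∀ b →
  (∀ n → n < b → ¬ P n) ⊎ Σ ℕ (λ k → k < b × P k × (∀ n → n < k → ¬ P n))
least-below P P? zero = inj₁ (λ n ())
least-below P P? (suc b) with least-below P P? b
... | inj₂ (k , k<b , Pk , least) = inj₂ (k , m<n⇒m<1+n k<b , Pk , least)
... | inj₁ none with P? b
...   | yes Pb  = inj₂ (b , ≤-refl , Pb , none)
...   | no ¬Pb  = inj₁ below
  where below : ∀ n → n < suc b → ¬ P n
        below n n<1+b with m≤n⇒m<n∨m≡n (≤-pred n<1+b)
        ... | inj₁ n<b  = none n n<b
        ... | inj₂ refl = ¬Pb

module CyclicOrbit {A : Set} (_≟_ : DecidableEquality A) (x : ℕ → A) (d' : ℕ)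
  (equivariant : ∀ a b b' → x b ≡ x b' → x (a + b) ≡ x (a + b'))
  (closes : x (suc d') ≡ x 0) where

  d : ℕ
  d = suc d'

  returns : ℕ → Set
  returns k = x (suc k) ≡ x 0

  least-return : Σ ℕ (λ k → k < d × returns k × (∀ n → n < k → ¬ returns n))
  least-return with least-below returns (λ k → x (suc k) ≟ x 0) d
  ... | inj₁ none  = ⊥-elim (none d' ≤-refl closes)
  ... | inj₂ found = found

  L : ℕ
  L = suc (proj₁ least-return)

  L≤d : L ≤ d
  L≤d = proj₁ (proj₂ least-return)

  period-returns : x L ≡ x 0
  period-returns = proj₁ (proj₂ (proj₂ least-return))

  no-return : ∀ k → 0 < k → k < L → x k ≢ x 0
  no-return (suc k) _ k<L = proj₂ (proj₂ (proj₂ least-return)) k (≤-pred k<L)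

  periodic : ∀ k → x (k + L) ≡ x k
  periodic k = trans (equivariant k L 0 period-returns) (cong x (+-identityʳ k))

  reduce : ∀ k → x k ≡ x (k % L)
  reduce k = trans (cong x (m≡m%n+[m/n]*n k L)) (periods (k / L) (k % L))
    where periods : ∀ t r → x (r + t * L) ≡ x r
          periods zero    r = cong x (+-identityʳ r)
          periods (suc t) r = begin
            x (r + (L + t * L)) ≡⟨ cong x (trans (cong (r +_) (+-comm L (t * L))) (sym (+-assoc r (t * L) L))) ⟩
            x (r + t * L + L)   ≡⟨ periodic (r + t * L) ⟩
            x (r + t * L)       ≡⟨ periods t r ⟩
            x r                 ∎
            where open ≡-Reasoning

  -- d = t · L: a nonzero remainder d % L < L would be an earlier return.
  t : ℕ
  t = d / L

  d≡tL : d ≡ t * L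
  d≡tL with d % L in rem
  ... | zero  = trans (m≡m%n+[m/n]*n d L) (cong (_+ t * L) rem)
  ... | suc r = ⊥-elim (no-return (suc r) (s≤s z≤n) (subst (_< L) rem (m%n<n d L))
                          (trans (sym (subst (λ k → x d ≡ x k) rem (reduce d))) closes))

  -- x is injective on [0, L): from x i = x j with i < j < L, translating by
  -- L - j gives a return at time L - j + i strictly between 0 and L.
  injective-below : ∀ {i j} → i < j → j < L → x i ≢ x j
  injective-below {i} {j} i<j j<L xi≡xj = no-return (L ∸ j + i) positive below returned
    where
      positive : 0 < L ∸ j + i
      positive = ≤-trans (m<n⇒0<n∸m j<L) (m≤m+n (L ∸ j) i)
      below : L ∸ j + i < L
      below = subst (L ∸ j + i <_) (m∸n+n≡m (<⇒≤ j<L)) (+-monoʳ-< (L ∸ j) i<j)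
      returned : x (L ∸ j + i) ≡ x 0
      returned = trans (equivariant (L ∸ j) i j xi≡xj)
                       (trans (cong x (m∸n+n≡m (<⇒≤ j<L))) period-returns)

  dedup-orbit : List A
  dedup-orbit = deduplicate _≟_ (map x (upTo d))

  orbit-↭ : dedup-orbit ↭ map x (upTo L)
  orbit-↭ = ∼bag⇒↭ (unique∧set⇒bag (deduplicate-! _≟_ (map x (upTo d))) unique-period same-elements)
    where
      unique-period : Unique (map x (upTo L))
      unique-period = subst Unique (sym (map-upTo x L)) (AllPairs.applyUpTo⁺₁ x L injective-below)
      into-period : ∀ {z} → z ∈ dedup-orbit → z ∈ map x (upTo L)
      into-period z∈ with ∈-map⁻ x (Equivalence.from (deduplicate-∈⇔ _≟_ {map x (upTo d)}) z∈)
      ... | k , _ , refl = subst (_∈ map x (upTo L)) (sym (reduce k)) (∈-map⁺ x (∈-upTo⁺ (m%n<n k L)))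
      into-orbit : ∀ {z} → z ∈ map x (upTo L) → z ∈ dedup-orbit
      into-orbit z∈ with ∈-map⁻ x z∈
      ... | k , k∈ , refl = Equivalence.to (deduplicate-∈⇔ _≟_) (∈-map⁺ x (∈-upTo⁺ (≤-trans (∈-upTo⁻ k∈) L≤d)))
      same-elements : ∀ {z} → z ∈ dedup-orbit ⇔ z ∈ map x (upTo L)
      same-elements = mk⇔ into-period into-orbit

  orbit-length : length dedup-orbit ≡ L
  orbit-length = trans (↭-length orbit-↭) (trans (length-map x (upTo L)) (length-upTo L))

  orbit-sum : ∀ (g : A → ℕ) → sum (map g dedup-orbit) ≡ Σ< L (g ∘ x)
  orbit-sum g = begin
    sum (map g dedup-orbit)            ≡⟨ sum-↭ (map⁺ g orbit-↭) ⟩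
    sum (map g (map x (upTo L))) ≡⟨ cong sum (sym (map-∘ (upTo L))) ⟩
    sum (map (g ∘ x) (upTo L))   ≡⟨ sum-upTo L (g ∘ x) ⟩
    Σ< L (g ∘ x)                 ∎
    where open ≡-Reasoning

  full-sum : ∀ (g : A → ℕ) → Σ< d (g ∘ x) ≡ t * Σ< L (g ∘ x)
  full-sum g = trans (cong (λ k → Σ< k (g ∘ x)) d≡tL) (Σ-periodic L t (g ∘ x) (λ k → cong g (periodic k)))

qbracket-pSum : ∀ q m n' d e α → length α ≡ m → sum α ≡ suc n' → m ≡ d * e →
  qbracket (suc n') m d e α q ≡ pSum (suc n') m d e α q
qbracket-pSum q m n' zero     e α _  _  _    = refl
qbracket-pSum q m n' (suc d') e α lm sm m≡de =
  div-exact _ _ _ (s≤s z≤n) (trans (sym (pSum-cleared q m n' (suc d') e α lm sm m≡de)) (*-comm (qint (suc d') (q ^ (suc n' * e))) _))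

-- The third identity for d ≥ 1.  The C_d-orbit of ᾱ = ((α_1), …, (α_m)) is
-- traced by x k = σ^{k e} ᾱ; with L its size and t = d / L, every sum over
-- C_d is t times the corresponding sum over the orbit.  Using MacMahon's
-- theorem for SYT(ᾱ), the fake degree is the orbit part of pSum, and
-- #orbit · [[n; α]] = L · t · (orbit part) = d · g.
module OneRowOrbit (q m n' d' e : ℕ) (α : List ℕ) (lm : length α ≡ m) (sm : sum α ≡ suc n')
                   (m≡de : m ≡ suc d' * e) where
  n : ℕ
  n = suc n'
  d : ℕ
  d = suc d'
  Q : ℕ
  Q = q ^ m

  x : ℕ → PSeq
  x k = rotPow (k * e) (oneRow α)

  equivariant : ∀ a b b' → x b ≡ x b' → x (a + b) ≡ x (a + b')
  equivariant a b b' eq = begin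
    rotPow ((a + b) * e) (oneRow α)   ≡⟨ cong (λ k → rotPow k (oneRow α)) (*-distribʳ-+ e a b) ⟩
    rotPow (a * e + b * e) (oneRow α) ≡⟨ rotPow-+ (a * e) (b * e) (oneRow α) ⟩
    rotPow (a * e) (x b)              ≡⟨ cong (rotPow (a * e)) eq ⟩
    rotPow (a * e) (x b')             ≡⟨ sym (rotPow-+ (a * e) (b' * e) (oneRow α)) ⟩
    rotPow (a * e + b' * e) (oneRow α) ≡⟨ cong (λ k → rotPow k (oneRow α)) (sym (*-distribʳ-+ e a b')) ⟩
    rotPow ((a + b') * e) (oneRow α)  ∎
    where open ≡-Reasoning

  closes : x d ≡ x 0
  closes = trans (cong (λ k → rotPow k (oneRow α)) (trans (sym m≡de) (trans (sym lm) (sym (length-map _ α)))))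
                 (rotPow-length (oneRow α))

  open CyclicOrbit (≡-dec (≡-dec _≟_)) x d' equivariant closes using (L; t; d≡tL; orbit-length; orbit-sum; full-sum)

  sizes-x : ∀ k → sizes (x k) ≡ rotPow (k * e) α
  sizes-x k = trans (map-rotPow sum (k * e) (oneRow α)) (cong (rotPow (k * e)) (sizes-oneRow α))
    where sizes-oneRow : ∀ α → sizes (oneRow α) ≡ α
          sizes-oneRow []      = refl
          sizes-oneRow (a ∷ α) = cong₂ _∷_ (+-identityʳ a) (sizes-oneRow α)

  weight : PSeq → ℕ
  weight μ = q ^ bstat (sizes μ)

  pWeight : PSeq → ℕ
  pWeight μ = weight μ * pPoly n e (sizes μ) Q

  sumCd-orbit : sumCd d e α q ≡ t * Σ< L (weight ∘ x)
  sumCd-orbit = begin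
    sumCd d e α q                                ≡⟨ sum-upTo d _ ⟩
    Σ< d (λ k → q ^ bstat (rotPow (k * e) α))    ≡⟨ Σ-ext d (λ k → cong (λ γ → q ^ bstat γ) (sym (sizes-x k))) ⟩
    Σ< d (weight ∘ x)                            ≡⟨ full-sum weight ⟩
    t * Σ< L (weight ∘ x)                        ∎
    where open ≡-Reasoning

  pSum-orbit : pSum n m d e α q ≡ t * Σ< L (pWeight ∘ x)
  pSum-orbit = begin
    pSum n m d e α q                                        ≡⟨ sum-upTo d _ ⟩
    Σ< d (λ k → q ^ bstat (rotPow (k * e) α) * pPoly n e (rotPow (k * e) α) Q)
      ≡⟨ Σ-ext d (λ k → cong (λ γ → q ^ bstat γ * pPoly n e γ Q) (sym (sizes-x k))) ⟩
    Σ< d (pWeight ∘ x)                                      ≡⟨ full-sum pWeight ⟩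
    t * Σ< L (pWeight ∘ x)                                  ∎
    where open ≡-Reasoning

  -- g = (Σ_{orbit} q^b) · binom(n; α)_{q^m} / [d]_{q^{ne}} is the orbit part of pSum:
  -- multiplying by t turns both sides into the two sides of pSum-cleared.
  fakeDeg-orbit : fakeDeg n m d e (oneRow α) q ≡ Σ< L (pWeight ∘ x)
  fakeDeg-orbit = begin
    fakeDeg n m d e (oneRow α) q ≡⟨ cong₂ (λ a b → (a * b) div D) (orbit-sum weight) (sytMaj-oneRow Q α n' sm) ⟩
    (O * B) div D                ≡⟨ div-exact (O * B) D S (s≤s z≤n) (*-cancelʳ-pos t (O * B) (S * D) t≥1 cleared) ⟩
    S                            ∎
    where
      open ≡-Reasoning
      D = qint d (q ^ (n * e))
      B : ℕ
      B = binomℕ n α Q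
      O : ℕ
      O = Σ< L (weight ∘ x)
      S : ℕ
      S = Σ< L (pWeight ∘ x)
      t≥1 : 1 ≤ t
      t≥1 with t | d≡tL
      ... | suc _ | _ = s≤s z≤n
      shuffle : ∀ a b c → a * b * c ≡ b * (c * a)
      shuffle = solve-∀
      cleared : O * B * t ≡ S * D * t
      cleared = begin
        O * B * t                ≡⟨ shuffle O B t ⟩
        B * (t * O)              ≡⟨ *-comm B _ ⟩
        t * O * B                ≡⟨ cong (_* B) (sym sumCd-orbit) ⟩
        sumCd d e α q * B        ≡⟨ sym (pSum-cleared q m n' d e α lm sm m≡de) ⟩
        D * pSum n m d e α q     ≡⟨ cong (D *_) pSum-orbit ⟩
        D * (t * S)              ≡⟨ sym (shuffle S D t) ⟩
        S * D * t                ∎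

  orbit-identity : length (orbit d e (oneRow α)) * qbracket n m d e α q ≡ d * fakeDeg n m d e (oneRow α) q
  orbit-identity = begin
    length (orbit d e (oneRow α)) * qbracket n m d e α q
      ≡⟨ cong₂ _*_ orbit-length (trans (qbracket-pSum q m n' d e α lm sm m≡de) pSum-orbit) ⟩
    L * (t * Σ< L (pWeight ∘ x))  ≡⟨ regroup L t _ ⟩
    t * L * Σ< L (pWeight ∘ x)    ≡⟨ cong₂ _*_ (sym d≡tL) (sym fakeDeg-orbit) ⟩
    d * fakeDeg n m d e (oneRow α) q ∎
    where open ≡-Reasoning
          regroup : ∀ a b c → a * (b * c) ≡ b * a * c
          regroup = solve-∀

-- For d = 0 both sides vanish: the orbit is empty.
fakeDeg-identity : ∀ q m n' d e α → length α ≡ m → sum α ≡ suc n' → m ≡ d * e →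
  length (orbit d e (oneRow α)) * qbracket (suc n') m d e α q ≡ d * fakeDeg (suc n') m d e (oneRow α) q
fakeDeg-identity q m n' zero     e α _  _  _    = refl
fakeDeg-identity q m n' (suc d') e α lm sm m≡de = OneRowOrbit.orbit-identity q m n' d' e α lm sm m≡de

corollary7p12 : (m n d : ℕ) (α : Vec ℕ m) → sum (toList α) ≡ n → 1 ≤ n → (dm : d ∣ m) →
    (q : ℕ) →
      (qint d (q ^ (n * _∣_.quotient dm)) * qbracket n m d (_∣_.quotient dm) (toList α) q
         ≡ sumCd d (_∣_.quotient dm) (toList α) q * binomℕ n (toList α) (q ^ m))
    × (qbracket n m d (_∣_.quotient dm) (toList α) q
         ≡ sum (map (λ k → q ^ bstat (rotPow (k * _∣_.quotient dm) (toList α))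
                           * pPoly n (_∣_.quotient dm) (rotPow (k * _∣_.quotient dm) (toList α)) (q ^ m))
                    (upTo d)))
    × (length (orbit d (_∣_.quotient dm) (oneRow (toList α))) * qbracket n m d (_∣_.quotient dm) (toList α) q
         ≡ d * fakeDeg n m d (_∣_.quotient dm) (oneRow (toList α)) q)
corollary7p12 m zero     d α sm ()  dm q
corollary7p12 m (suc n') d α sm n≥1 dm q =
    trans (cong (qint d (q ^ (suc n' * e)) *_) bracket) (pSum-cleared q m n' d e α' lm sm m≡de)
  , bracket
  , fakeDeg-identity q m n' d e α' lm sm m≡de
  where
    e : ℕ
    e = _∣_.quotient dm
    α' : List ℕ
    α' = toList α
    lm : length α' ≡ m
    lm = length-toList α
    m≡de : m ≡ d * e
    m≡de = trans (_∣_.equality dm) (*-comm e d)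
    bracket : qbracket (suc n') m d e α' q ≡ pSum (suc n') m d e α' q
    bracket = qbracket-pSum q m n' d e α' lm sm m≡de
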